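{- The set of permutations sorted (i.e. transformed into $12\cdots n$) by the algorithm PSBP is the class $\mathrm{Av}(2341,25314,42513,42531,45213,45231,52314,642135,642153)$.
   Context: $\mathrm{Av}(T)$ is the set of permutations avoiding every pattern in $T$ (a permutation contains $\rho\in S_k$ if some length-$k$ subsequence has entries in the same relative order as $\rho$). PSBP uses two pop stacks $S_1,S_2$ (initially empty; a pop of $S_j$ removes all its elements and appends them to the output from top to bottom) and processes $\pi=\pi_1\cdots\pi_n$ from left to right. For $i=1,\dots,n$, with $\mathrm{TOP}(S_j)$ the top element of $S_j$ (a condition involving $\mathrm{TOP}$ of an empty stack counts as false): if $\pi_i=\mathrm{TOP}(S_1)-1$, push $\pi_i$ onto $S_1$; else if $\pi_i=\mathrm{TOP}(S_2)-1$, push onto $S_2$; else if $S_1$ is empty, push onto $S_1$; else if $S_2$ is empty, push onto $S_2$; else if $\pi_i<\max(\mathrm{TOP}(S_1)-1,\mathrm{TOP}(S_2)-1)$, append $\pi_i$ to the output (bypass); else, if $\mathrm{TOP}(S_1)<\mathrm{TOP}(S_2)$ pop $S_1$ and push $\pi_i$ onto $S_1$, otherwise pop $S_2$ and push $\pi_i$ onto $S_2$. After processing all entries: if $S_1$ is empty pop $S_2$; else if $S_2$ is empty pop $S_1$; else if $\mathrm{TOP}(S_1)<\mathrm{TOP}(S_2)$ pop $S_1$ then $S_2$; otherwise pop $S_2$ then $S_1$. -}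

module Defs where

open import Data.Nat using (ℕ; zero; suc; _<_; _⊓_; _∸_)
open import Data.Nat.Properties using (_≟_; _<?_)
open import Data.Bool using (Bool; true; false; if_then_else_)
open import Data.List using (List; []; _∷_; _++_; map; upTo)
open import Data.List.Relation.Unary.All using (All)
open import Data.List.Relation.Binary.Pointwise using (Pointwise)
open import Data.List.Relation.Binary.Sublist.Propositional using (_⊆_)
open import Data.List.Relation.Binary.Permutation.Propositional using (_↭_)
open import Data.Product using (Σ; _×_; _,_)
open import Relation.Nullary using (¬_; does)
open import Function.Bundles using (_⇔_)

oneTo : ℕ → List ℕ
oneTo n = map suc (upTo n)

IsPerm : ℕ → List ℕ → Set
IsPerm n π = π ↭ oneTo n

SameRel : ℕ → ℕ → ℕ → ℕ → Set
SameRel a b c d = ((a < b) ⇔ (c < d)) × ((b < a) ⇔ (d < c))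

OrderIso : List ℕ → List ℕ → Set
OrderIso []       []       = Data.Unit.⊤ where import Data.Unit
OrderIso []       (_ ∷ _)  = Data.Empty.⊥ where import Data.Empty
OrderIso (_ ∷ _)  []       = Data.Empty.⊥ where import Data.Empty
OrderIso (x ∷ xs) (y ∷ ys) =
  Pointwise (λ x' y' → SameRel x x' y y') xs ys × OrderIso xs ys

Contains : List ℕ → List ℕ → Set
Contains π ρ = Σ (List ℕ) (λ σ → (σ ⊆ π) × OrderIso σ ρ)

Avoids : List ℕ → List ℕ → Set
Avoids π ρ = ¬ Contains π ρ

Av : List (List ℕ) → List ℕ → Set
Av T π = All (Avoids π) T

-- The algorithm PSBP (bypass test uses min).  A stack is a list whose head is the top.
-- Popping appends the whole stack, top to bottom, to the output.

record State : Set where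
  constructor st
  field
    s1  : List ℕ
    s2  : List ℕ
    out : List ℕ

isPred : ℕ → List ℕ → Bool
isPred x []      = false
isPred x (t ∷ _) = does (suc x ≟ t)

step : State → ℕ → State
step (st S1 S2 out) x =
  if isPred x S1 then st (x ∷ S1) S2 out
  else if isPred x S2 then st S1 (x ∷ S2) out
  else stepRest S1 S2
  where
  stepRest : List ℕ → List ℕ → State
  stepRest []        S2'        = st (x ∷ []) S2' out
  stepRest (t ∷ r)   []         = st (t ∷ r) (x ∷ []) out
  stepRest (t ∷ r) (u ∷ v) =
    if does (x <? ((t ∸ 1) ⊓ (u ∸ 1)))
      then st (t ∷ r) (u ∷ v) (out ++ (x ∷ []))
      else (if does (t <? u)
              then st (x ∷ []) (u ∷ v) (out ++ (t ∷ r))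
              else st (t ∷ r) (x ∷ []) (out ++ (u ∷ v)))

run : State → List ℕ → State
run s []       = s
run s (x ∷ xs) = run (step s x) xs

finish : State → List ℕ
finish (st []      S2      out) = out ++ S2
finish (st (t ∷ r) []      out) = out ++ (t ∷ r)
finish (st (t ∷ r) (u ∷ v) out) =
  if does (t <? u) then out ++ (t ∷ r) ++ (u ∷ v)
                   else out ++ (u ∷ v) ++ (t ∷ r)

PSBP : List ℕ → List ℕ
PSBP π = finish (run (st [] [] []) π)

SortedByPSBP : List ℕ → ℕ → Set
SortedByPSBP π n = PSBP π Relation.Binary.PropositionalEquality.≡ oneTo n
  where import Relation.Binary.PropositionalEquality

basis : List (List ℕ)
basis =
    (2 ∷ 3 ∷ 4 ∷ 1 ∷ [])
  ∷ (2 ∷ 5 ∷ 3 ∷ 1 ∷ 4 ∷ [])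
  ∷ (4 ∷ 2 ∷ 5 ∷ 1 ∷ 3 ∷ [])
  ∷ (4 ∷ 2 ∷ 5 ∷ 3 ∷ 1 ∷ [])
  ∷ (4 ∷ 5 ∷ 2 ∷ 1 ∷ 3 ∷ [])
  ∷ (4 ∷ 5 ∷ 2 ∷ 3 ∷ 1 ∷ [])
  ∷ (5 ∷ 2 ∷ 3 ∷ 1 ∷ 4 ∷ [])
  ∷ (6 ∷ 4 ∷ 2 ∷ 1 ∷ 3 ∷ 5 ∷ [])
  ∷ (6 ∷ 4 ∷ 2 ∷ 1 ∷ 5 ∷ 3 ∷ [])
  ∷ []

-- Throughout the run each stack holds consecutive values t, t + 1, ... read from the
-- top, pushed in decreasing order, and its top t is waiting for t − 1: t − 1 has not
-- been read after t.  If π contains a basis pattern, cutting π after the pattern's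
-- third entry leaves an unread entry w and three larger values, each waiting for its
-- predecessor; all three must still be on the two stacks when w is read, yet two
-- waiting values never share a stack.  Conversely, PSBP keeps its output increasing
-- and below everything not yet output unless it reads some x while a later y is
-- smaller than x and both tops t, u; comparing x with t and u, and placing t − 1 and
-- u − 1 among the other entries, then always exhibits one of the nine basis patterns.

module Submission where

open import Defs
open import Data.Bool using (true; false; T)
open import Data.Empty using (⊥; ⊥-elim)
open import Data.List using (List; []; _∷_; _++_; [_]; length; map; take; drop)
open import Data.List.Properties using (++-assoc; ++-identityʳ; length-++; length-take; take++drop≡id)
open import Data.List.Membership.Propositional using (_∈_; _∉_; find)
open import Data.List.Membership.Propositional.Properties
  using (∈-map⁻; ∈-map⁺; ∈-upTo⁻; ∈-upTo⁺; ∈-++⁺ˡ; ∈-++⁺ʳ; ∈-++⁻)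
open import Data.List.Relation.Binary.Permutation.Propositional
  using (_↭_; ↭-sym; ↭-refl; ↭-trans; ↭⇒↭ₛ; prep; module PermutationReasoning)
open import Data.List.Relation.Binary.Permutation.Propositional.Properties
  using (∈-resp-↭; ++⁺ˡ; shift; shifts; ∷↭∷ʳ; ++-comm)
import Data.List.Relation.Binary.Permutation.Setoid.Properties as SetoidPermutation
open import Data.List.Relation.Binary.Pointwise using (Pointwise; []; _∷_)
open import Data.List.Relation.Binary.Sublist.Propositional using (_⊆_; []; _∷_; _∷ʳ_)
import Data.List.Relation.Binary.Sublist.Propositional as Sublist
open import Data.List.Relation.Binary.Sublist.Propositional.Properties using (All-resp-⊆)
open import Data.List.Relation.Unary.All as All using (All; []; _∷_; all?)
open import Data.List.Relation.Unary.All.Properties using (¬Any⇒All¬) renaming (++⁻ˡ to All-++⁻ˡ)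
open import Data.List.Relation.Unary.AllPairs as AllPairs using (AllPairs; []; _∷_)
import Data.List.Relation.Unary.AllPairs.Properties as AllPairs
open import Data.List.Relation.Unary.Any using (here; there; any?)
open import Data.List.Relation.Unary.Linked as Linked using (Linked; []; [-]; _∷_)
open import Data.List.Relation.Unary.Linked.Properties using (Linked⇒AllPairs; AllPairs⇒Linked)
open import Data.List.Relation.Unary.Unique.Propositional using (Unique)
import Data.List.Relation.Unary.Unique.Propositional.Properties as Unique
open import Data.Nat
open import Data.Nat.Properties
open import Data.Product using (Σ; _×_; _,_; proj₁; proj₂)
open import Data.Sum as Sum using (_⊎_; inj₁; inj₂)
open import Data.Unit using (⊤; tt)
open import Function using (_∘_; flip)
open import Function.Bundles using (_⇔_; mk⇔; Equivalence)
open import Relation.Binary.Definitions using (Tri; tri<; tri≈; tri>)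
open import Relation.Binary.PropositionalEquality hiding ([_])
open import Relation.Nullary using (¬_; yes; no)
open import Relation.Nullary.Decidable using (True; toWitness; _×-dec_)
open import Data.List.Relation.Unary.Sorted.TotalOrder.Properties using (↗↭↗⇒≋)
open import Data.List.Relation.Binary.Equality.Propositional using (≋⇒≡)

-- Junk value: position L v = length L when v ∉ L.
position : List ℕ → ℕ → ℕ
position []       v = 0
position (x ∷ xs) v with x ≟ v
... | yes _ = 0
... | no  _ = suc (position xs v)

Precedes : List ℕ → ℕ → ℕ → Set
Precedes L a b = position L a < position L b

position-here : ∀ {x L} → position (x ∷ L) x ≡ 0
position-here {x} with x ≟ x
... | yes _ = refl
... | no x≢x = ⊥-elim (x≢x refl)

position-there : ∀ {x L v} → x ≢ v → position (x ∷ L) v ≡ suc (position L v)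
position-there {x} {v = v} x≢v with x ≟ v
... | yes x≡v = ⊥-elim (x≢v x≡v)
... | no  _   = refl

position<length : ∀ {L v} → v ∈ L → position L v < length L
position<length {x ∷ L} {v} v∈ with x ≟ v | v∈
... | yes _   | _          = s≤s z≤n
... | no  x≢v | here refl  = ⊥-elim (x≢v refl)
... | no  _   | there v∈L  = s≤s (position<length v∈L)

position<length⇒∈ : ∀ {L v} → position L v < length L → v ∈ L
position<length⇒∈ {x ∷ L} {v} lt with x ≟ v
... | yes refl = here refl
... | no  _    = there (position<length⇒∈ (≤-pred lt))

position-injective : ∀ {L v w} → w ∈ L → position L v ≡ position L w → v ≡ w
position-injective {x ∷ L} {v} {w} w∈ eq with x ≟ v | x ≟ w | w∈
... | yes refl | yes refl | _         = refl
... | no  _    | no  _    | there w∈L = position-injective w∈L (suc-injective eq)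
... | no  _    | no  x≢w  | here refl = ⊥-elim (x≢w refl)

position-++ˡ : ∀ {P S v} → v ∈ P → position (P ++ S) v ≡ position P v
position-++ˡ {x ∷ P} {S} {v} v∈ with x ≟ v | v∈
... | yes _   | _         = refl
... | no  x≢v | here refl = ⊥-elim (x≢v refl)
... | no  _   | there v∈P = cong suc (position-++ˡ v∈P)

position-++ʳ : ∀ {P S v} → v ∉ P → position (P ++ S) v ≡ length P + position S v
position-++ʳ {[]}    _   = refl
position-++ʳ {x ∷ P} {S} {v} v∉ with x ≟ v
... | yes refl = ⊥-elim (v∉ (here refl))
... | no  _    = cong suc (position-++ʳ (λ v∈P → v∉ (there v∈P)))

∈-take : ∀ {L v k} → v ∈ L → position L v < k → v ∈ take k L
∈-take {x ∷ L} {v} {suc k} v∈ lt with x ≟ v | v∈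
... | yes refl | _         = here refl
... | no  x≢v  | here refl = ⊥-elim (x≢v refl)
... | no  _    | there v∈L = there (∈-take v∈L (≤-pred lt))

∈-drop : ∀ {L v k} → v ∈ L → k ≤ position L v → v ∈ drop k L
∈-drop {L}     {v} {zero}  v∈ _ = v∈
∈-drop {x ∷ L} {v} {suc k} v∈ le with x ≟ v | v∈
... | no  x≢v  | here refl = ⊥-elim (x≢v refl)
... | no  _    | there v∈L = ∈-drop v∈L (≤-pred le)

precedes-there : ∀ {x L a b} → x ≢ a → x ≢ b → Precedes L a b → Precedes (x ∷ L) a b
precedes-there x≢a x≢b lt = subst₂ _<_ (sym (position-there x≢a)) (sym (position-there x≢b)) (s≤s lt)

precedes-there⁻ : ∀ {x L a b} → x ≢ a → x ≢ b → Precedes (x ∷ L) a b → Precedes L a b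
precedes-there⁻ x≢a x≢b lt = ≤-pred (subst₂ _<_ (position-there x≢a) (position-there x≢b) lt)

first-precedes : ∀ {x L b} → x ≢ b → Precedes (x ∷ L) x b
first-precedes x≢b = subst₂ _<_ (sym position-here) (sym (position-there x≢b)) (s≤s z≤n)

nothing-precedes-first : ∀ {x L a} → ¬ Precedes (x ∷ L) a x
nothing-precedes-first {x} {L} {a} lt = n≮0 (subst (position (x ∷ L) a <_) position-here lt)

module _ {A : Set} {Q : A → Set} {R S : A → A → Set} where

  allPairs-mapWith : (∀ {a b} → Q a → Q b → R a b → S a b) →
                     ∀ {xs} → All Q xs → AllPairs R xs → AllPairs S xs
  allPairs-mapWith f []        []        = []
  allPairs-mapWith f (qa ∷ qs) (ra ∷ rs) =
    All.zipWith (λ (qb , r) → f qa qb r) (qs , ra) ∷ allPairs-mapWith f qs rs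

⊆⇒precedes : ∀ {σ L} → σ ⊆ L → Unique L → AllPairs (Precedes L) σ
⊆⇒precedes []           _          = []
⊆⇒precedes (x ∷ʳ σ⊆L)   (x∉L ∷ !L) =
  allPairs-mapWith precedes-there (All-resp-⊆ σ⊆L x∉L) (⊆⇒precedes σ⊆L !L)
⊆⇒precedes {x ∷ σ} (refl ∷ σ⊆L) (x∉L ∷ !L) =
  All.map first-precedes x∉σ ∷ allPairs-mapWith precedes-there x∉σ (⊆⇒precedes σ⊆L !L)
  where
  x∉σ : All (x ≢_) σ
  x∉σ = All-resp-⊆ σ⊆L x∉L

∈-tail-all : ∀ {c : ℕ} {L σ} → All (c ≢_) σ → All (_∈ (c ∷ L)) σ → All (_∈ L) σ
∈-tail-all c≢σ σ∈ = All.zipWith (λ { (c≢b , here refl) → ⊥-elim (c≢b refl) ; (_ , there b∈) → b∈ }) (c≢σ , σ∈)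

first-not-after : ∀ {c L a σ} → All (Precedes (c ∷ L) a) σ → All (c ≢_) σ
first-not-after = All.map λ { a≺c refl → nothing-precedes-first a≺c }

precedes⇒⊆ : ∀ {L σ} → All (_∈ L) σ → AllPairs (Precedes L) σ → σ ⊆ L
precedes⇒⊆ {[]}    []         []          = []
precedes⇒⊆ {c ∷ L} []         []          = c ∷ʳ precedes⇒⊆ [] []
precedes⇒⊆ {c ∷ L} {a ∷ σ} (a∈ ∷ σ∈) (a≺ ∷ σ≺) with c ≟ a | first-not-after a≺
... | yes refl | c≢σ = refl ∷ precedes⇒⊆ (∈-tail-all c≢σ σ∈) (allPairs-mapWith precedes-there⁻ c≢σ σ≺)
... | no c≢a   | c≢σ = c ∷ʳ precedes⇒⊆ (∈-tail-all (c≢a ∷ c≢σ) (a∈ ∷ σ∈))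
                                       (allPairs-mapWith precedes-there⁻ (c≢a ∷ c≢σ) (a≺ ∷ σ≺))

unique-resp-↭ : ∀ {xs ys : List ℕ} → xs ↭ ys → Unique xs → Unique ys
unique-resp-↭ p = SetoidPermutation.Unique-resp-↭ (setoid ℕ) (↭⇒↭ₛ p)

unique-++ˡ : ∀ (xs : List ℕ) {ys} → Unique (xs ++ ys) → Unique xs
unique-++ˡ []       _          = []
unique-++ˡ (x ∷ xs) (x∉ ∷ !xs) = All-++⁻ˡ xs x∉ ∷ unique-++ˡ xs !xs

unique-++ʳ : ∀ (xs : List ℕ) {ys} → Unique (xs ++ ys) → Unique ys
unique-++ʳ []       !ys       = !ys
unique-++ʳ (x ∷ xs) (_ ∷ !xs) = unique-++ʳ xs !xs

unique-++⇒disjoint : ∀ (xs : List ℕ) {ys v} → Unique (xs ++ ys) → v ∈ xs → v ∈ ys → ⊥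
unique-++⇒disjoint (x ∷ xs) (x∉ ∷ _) (here refl) v∈ys = All.lookup x∉ (∈-++⁺ʳ xs v∈ys) refl
unique-++⇒disjoint (x ∷ xs) (_ ∷ !xs) (there v∈xs) v∈ys = unique-++⇒disjoint xs !xs v∈xs v∈ys

allPairs-++⇒ : ∀ {R : ℕ → ℕ → Set} (xs : List ℕ) {ys a b} → AllPairs R (xs ++ ys) → a ∈ xs → b ∈ ys → R a b
allPairs-++⇒ (x ∷ xs) (Rx ∷ _)  (here refl) b∈ = All.lookup Rx (∈-++⁺ʳ xs b∈)
allPairs-++⇒ (x ∷ xs) (_ ∷ Rxs) (there a∈)  b∈ = allPairs-++⇒ xs Rxs a∈ b∈

strictlySorted-↭⇒≡ : ∀ {L M : List ℕ} → AllPairs _<_ L → AllPairs _<_ M → L ↭ M → L ≡ M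
strictlySorted-↭⇒≡ L↑ M↑ L↭M = ≋⇒≡ (↗↭↗⇒≋ ≤-totalOrder (sorted L↑) (sorted M↑) (↭⇒↭ₛ L↭M))
  where
  sorted : ∀ {L} → AllPairs _<_ L → Linked _≤_ L
  sorted = Linked.map <⇒≤ ∘ AllPairs⇒Linked

position-prefix : ∀ {P S v} → v ∈ P → position (P ++ S) v < length P
position-prefix {P} {S} {v} v∈P = subst (_< length P) (sym (position-++ˡ v∈P)) (position<length v∈P)

-- Indices count from 0; junk value nth L i = 0 when i ≥ length L.
nth : List ℕ → ℕ → ℕ
nth []       _       = 0
nth (x ∷ _)  zero    = x
nth (_ ∷ xs) (suc i) = nth xs i

nth-∈ : ∀ {L i} → i < length L → nth L i ∈ L
nth-∈ {x ∷ L} {zero}  _  = here refl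
nth-∈ {x ∷ L} {suc i} lt = there (nth-∈ (≤-pred lt))

nth-allPairs : ∀ {R : ℕ → ℕ → Set} {L i j} → AllPairs R L → i < j → j < length L → R (nth L i) (nth L j)
nth-allPairs {L = x ∷ L} {zero}  {suc j} (Rx ∷ _)  _   lt = All.lookup Rx (nth-∈ (≤-pred lt))
nth-allPairs {L = x ∷ L} {suc i} {suc j} (_ ∷ RL) i<j lt = nth-allPairs RL (≤-pred i<j) (≤-pred lt)

nth-pointwise : ∀ {S : ℕ → ℕ → Set} {σ ρ i} → Pointwise S σ ρ → i < length ρ → S (nth σ i) (nth ρ i)
nth-pointwise {i = zero}  (s ∷ _)  _  = s
nth-pointwise {i = suc i} (_ ∷ ss) lt = nth-pointwise ss (≤-pred lt)

orderIso-length : ∀ {σ ρ} → OrderIso σ ρ → length σ ≡ length ρ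
orderIso-length {[]}    {[]}    _        = refl
orderIso-length {_ ∷ σ} {_ ∷ ρ} (_ , σ≅ρ) = cong suc (orderIso-length σ≅ρ)

orderIso-nth : ∀ {σ ρ i j} → OrderIso σ ρ → i < length ρ → j < length ρ →
               nth ρ i < nth ρ j → nth σ i < nth σ j
orderIso-nth {_ ∷ _} {_ ∷ _} {zero}  {zero}  _          _  _  lt = ⊥-elim (<-irrefl refl lt)
orderIso-nth {_ ∷ _} {_ ∷ _} {zero}  {suc j} (pw , _)   _  jl lt =
  Equivalence.from (proj₁ (nth-pointwise pw (≤-pred jl))) lt
orderIso-nth {_ ∷ _} {_ ∷ _} {suc i} {zero}  (pw , _)   il _  lt =
  Equivalence.from (proj₂ (nth-pointwise pw (≤-pred il))) lt
orderIso-nth {_ ∷ _} {_ ∷ _} {suc i} {suc j} (_ , σ≅ρ) il jl lt =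
  orderIso-nth σ≅ρ (≤-pred il) (≤-pred jl) lt

record Occurrence (π ρ : List ℕ) : Set where
  field
    entry          : ℕ → ℕ
    entry∈         : ∀ {i} → i < length ρ → entry i ∈ π
    entry-precedes : ∀ {i j} → i < j → j < length ρ → Precedes π (entry i) (entry j)
    entry-ordered  : ∀ {i j} → i < length ρ → j < length ρ → nth ρ i < nth ρ j → entry i < entry j

contains⇒occurrence : ∀ {π ρ} → Unique π → Contains π ρ → Occurrence π ρ
contains⇒occurrence {π} {ρ} !π (σ , σ⊆π , σ≅ρ) = record
  { entry          = nth σ
  ; entry∈         = λ il → Sublist.lookup σ⊆π (nth-∈ (inσ il))
  ; entry-precedes = λ i<j jl → nth-allPairs (⊆⇒precedes σ⊆π !π) i<j (inσ jl)
  ; entry-ordered  = orderIso-nth σ≅ρ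
  }
  where
  inσ : ∀ {i} → i < length ρ → i < length σ
  inσ = subst (_ <_) (sym (orderIso-length σ≅ρ))

InRange : ℕ → ℕ → Set
InRange k j = 1 ≤ j × j ≤ k

StrictlyMonotoneOn : (ℕ → Set) → (ℕ → ℕ) → Set
StrictlyMonotoneOn D f = ∀ {a b} → D a → D b → a < b → f a < f b

monotone⇒sameRel : ∀ {D f a b} → StrictlyMonotoneOn D f → D a → D b → SameRel (f a) (f b) a b
monotone⇒sameRel {D} {f} mono Da Db = reflect Da Db , reflect Db Da
  where
  reflect : ∀ {a b} → D a → D b → (f a < f b) ⇔ (a < b)
  reflect {a} {b} Da Db = mk⇔ to (mono Da Db)
    where
    to : f a < f b → a < b
    to lt with <-cmp a b
    ... | tri< a<b _ _ = a<b
    ... | tri≈ _ refl _ = ⊥-elim (<-irrefl refl lt)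
    ... | tri> _ _ b<a = ⊥-elim (<-asym lt (mono Db Da b<a))

monotone⇒orderIso : ∀ {D f ρ} → StrictlyMonotoneOn D f → All D ρ → OrderIso (map f ρ) ρ
monotone⇒orderIso           mono []                  = tt
monotone⇒orderIso {D} {f} mono (_∷_ {x = a} Da Dρ) = pointwise Dρ , monotone⇒orderIso mono Dρ
  where
  pointwise : ∀ {ρ} → All D ρ → Pointwise (λ fb b → SameRel (f a) fb a b) (map f ρ) ρ
  pointwise []        = []
  pointwise (Db ∷ Dρ) = monotone⇒sameRel mono Da Db ∷ pointwise Dρ

-- The occurrence of a pattern ρ over 1..length c whose values, in increasing order, are c.
sortedValues⇒contains : ∀ {π ρ c} → Linked _<_ c → All (InRange (length c)) ρ →
                        let σ = map (λ j → nth c (j ∸ 1)) ρ in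
                        All (_∈ π) σ → Linked (Precedes π) σ → Contains π ρ
sortedValues⇒contains {π} {ρ} {c} c↑ ρ∈ σ∈ σ≺ =
  _ , precedes⇒⊆ σ∈ (Linked⇒AllPairs <-trans σ≺) , monotone⇒orderIso mono ρ∈
  where
  mono : StrictlyMonotoneOn (InRange (length c)) (λ j → nth c (j ∸ 1))
  mono {suc a} {suc b} _ (_ , b≤k) a<b = nth-allPairs (Linked⇒AllPairs <-trans c↑) (≤-pred a<b) b≤k

initial : State
initial = st [] [] []

≡ᵇ-true : ∀ {m n} → (m ≡ᵇ n) ≡ true → m ≡ n
≡ᵇ-true {m} {n} eq = ≡ᵇ⇒≡ m n (subst T (sym eq) tt)

≡ᵇ-false : ∀ {m n} → (m ≡ᵇ n) ≡ false → m ≢ n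
≡ᵇ-false {m} {n} eq m≡n = subst T eq (≡⇒≡ᵇ m n m≡n)

<ᵇ-true : ∀ {m n} → (suc m ≤ᵇ n) ≡ true → m < n
<ᵇ-true {m} {n} eq = ≤ᵇ⇒≤ (suc m) n (subst T (sym eq) tt)

<ᵇ-false : ∀ {m n} → (suc m ≤ᵇ n) ≡ false → ¬ m < n
<ᵇ-false {m} {n} eq m<n = subst T eq (≤⇒≤ᵇ m<n)

NotBelowTop : ℕ → List ℕ → Set
NotBelowTop x []      = ⊤
NotBelowTop x (t ∷ _) = suc x ≢ t

data StepView (out : List ℕ) (x : ℕ) : List ℕ → List ℕ → State → Set where
  push₁  : ∀ {t r S₂} → suc x ≡ t → StepView out x (t ∷ r) S₂ (st (x ∷ t ∷ r) S₂ out)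
  push₂  : ∀ {S₁ u v} → NotBelowTop x S₁ → suc x ≡ u →
           StepView out x S₁ (u ∷ v) (st S₁ (x ∷ u ∷ v) out)
  start₁ : ∀ {S₂} → NotBelowTop x S₂ → StepView out x [] S₂ (st (x ∷ []) S₂ out)
  start₂ : ∀ {t r} → suc x ≢ t → StepView out x (t ∷ r) [] (st (t ∷ r) (x ∷ []) out)
  bypass : ∀ {t r u v} → suc x ≢ t → suc x ≢ u → x < (t ∸ 1) ⊓ (u ∸ 1) →
           StepView out x (t ∷ r) (u ∷ v) (st (t ∷ r) (u ∷ v) (out ++ x ∷ []))
  pop₁   : ∀ {t r u v} → suc x ≢ t → suc x ≢ u → ¬ x < (t ∸ 1) ⊓ (u ∸ 1) → t < u →
           StepView out x (t ∷ r) (u ∷ v) (st (x ∷ []) (u ∷ v) (out ++ t ∷ r))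
  pop₂   : ∀ {t r u v} → suc x ≢ t → suc x ≢ u → ¬ x < (t ∸ 1) ⊓ (u ∸ 1) → ¬ t < u →
           StepView out x (t ∷ r) (u ∷ v) (st (t ∷ r) (x ∷ []) (out ++ u ∷ v))

stepView : ∀ S₁ S₂ out x → StepView out x S₁ S₂ (step (st S₁ S₂ out) x)
stepView []      []      out x = start₁ tt
stepView []      (u ∷ v) out x with suc x ≡ᵇ u in e
... | true  = push₂ tt (≡ᵇ-true e)
... | false = start₁ (≡ᵇ-false e)
stepView (t ∷ r) S₂      out x with suc x ≡ᵇ t in e₁
... | true  = push₁ (≡ᵇ-true e₁)
stepView (t ∷ r) []      out x | false = start₂ (≡ᵇ-false e₁)
stepView (t ∷ r) (u ∷ v) out x | false with suc x ≡ᵇ u in e₂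
... | true  = push₂ (≡ᵇ-false e₁) (≡ᵇ-true e₂)
... | false with suc x ≤ᵇ (t ∸ 1) ⊓ (u ∸ 1) in e₃
...   | true  = bypass (≡ᵇ-false e₁) (≡ᵇ-false e₂) (<ᵇ-true e₃)
...   | false with suc t ≤ᵇ u in e₄
...     | true  = pop₁ (≡ᵇ-false e₁) (≡ᵇ-false e₂) (<ᵇ-false e₃) (<ᵇ-true e₄)
...     | false = pop₂ (≡ᵇ-false e₁) (≡ᵇ-false e₂) (<ᵇ-false e₃) (<ᵇ-false e₄)

run-++ : ∀ s P Q → run s (P ++ Q) ≡ run (run s P) Q
run-++ s []      Q = refl
run-++ s (x ∷ P) Q = run-++ (step s x) P Q

Extends : List ℕ → List ℕ → Set
Extends L out = Σ (List ℕ) λ R → L ≡ out ++ R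

step-extends : ∀ s x → Extends (State.out (step s x)) (State.out s)
step-extends (st S₁ S₂ out) x with step (st S₁ S₂ out) x | stepView S₁ S₂ out x
... | _ | push₁ _        = [] , sym (++-identityʳ out)
... | _ | push₂ _ _      = [] , sym (++-identityʳ out)
... | _ | start₁ _       = [] , sym (++-identityʳ out)
... | _ | start₂ _       = [] , sym (++-identityʳ out)
... | _ | bypass _ _ _   = _ , refl
... | _ | pop₁ _ _ _ _   = _ , refl
... | _ | pop₂ _ _ _ _   = _ , refl

finish-extends : ∀ s → Extends (finish s) (State.out s)
finish-extends (st []      S₂      out) = S₂ , refl
finish-extends (st (t ∷ r) []      out) = _ , refl
finish-extends (st (t ∷ r) (u ∷ v) out) with suc t ≤ᵇ u
... | true  = _ , refl
... | false = _ , refl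

finish∘run-extends : ∀ s L → Extends (finish (run s L)) (State.out s)
finish∘run-extends s []      = finish-extends s
finish∘run-extends s (x ∷ L) with finish∘run-extends (step s x) L | step-extends s x
... | R , e | R′ , e′ = R′ ++ R , trans e (trans (cong (_++ R) e′) (++-assoc (State.out s) R′ R))

Consecutive : List ℕ → Set
Consecutive []          = ⊤
Consecutive (a ∷ [])    = ⊤
Consecutive (a ∷ b ∷ r) = b ≡ suc a × Consecutive (b ∷ r)

consecutive-head≤ : ∀ {t r v} → Consecutive (t ∷ r) → v ∈ t ∷ r → t ≤ v
consecutive-head≤ {t}         _         (here refl) = ≤-refl
consecutive-head≤ {t} {_ ∷ r} (refl , c) (there v∈) = ≤-trans (n≤1+n t) (consecutive-head≤ c v∈)

consecutive-interval : ∀ {t r v m} → Consecutive (t ∷ r) → t ≤ v → v ≤ m → m ∈ t ∷ r → v ∈ t ∷ r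
consecutive-interval {t} {r} {v} c t≤v v≤m m∈ with t ≟ v
... | yes refl = here refl
consecutive-interval {t} {r}     c t≤v v≤m (here refl) | no t≢v = ⊥-elim (t≢v (≤-antisym t≤v v≤m))
consecutive-interval {t} {_ ∷ r} (refl , c) t≤v v≤m (there m∈) | no t≢v =
  there (consecutive-interval c (≤∧≢⇒< t≤v t≢v) v≤m m∈)

consecutive-below : ∀ {t r a b} → Consecutive (t ∷ r) → a ∈ t ∷ r → b ∉ t ∷ r → t < b → a < b
consecutive-below {a = a} {b} c a∈ b∉ t<b with a <? b
... | yes a<b = a<b
... | no  a≮b = ⊥-elim (b∉ (consecutive-interval c (<⇒≤ t<b) (≮⇒≥ a≮b) a∈))

consecutive⇒sorted : ∀ {L} → Consecutive L → AllPairs _<_ L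
consecutive⇒sorted {[]}        _         = []
consecutive⇒sorted {a ∷ []}    _         = [] ∷ []
consecutive⇒sorted {a ∷ b ∷ r} (refl , c) = All.tabulate (consecutive-head≤ c) ∷ consecutive⇒sorted c

shift-middle : ∀ (x : ℕ) out S₁ S₂ → out ++ S₁ ++ x ∷ S₂ ↭ x ∷ out ++ S₁ ++ S₂
shift-middle x out S₁ S₂ = begin
  out ++ S₁ ++ x ∷ S₂   ≡⟨ ++-assoc out S₁ (x ∷ S₂) ⟨
  (out ++ S₁) ++ x ∷ S₂ ↭⟨ shift x (out ++ S₁) S₂ ⟩
  x ∷ (out ++ S₁) ++ S₂ ≡⟨ cong (x ∷_) (++-assoc out S₁ S₂) ⟩
  x ∷ out ++ S₁ ++ S₂   ∎
  where open PermutationReasoning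

step-rearranges : ∀ S₁ S₂ out x → let s = step (st S₁ S₂ out) x in
                  State.out s ++ State.s1 s ++ State.s2 s ↭ x ∷ out ++ S₁ ++ S₂
step-rearranges S₁ S₂ out x with step (st S₁ S₂ out) x | stepView S₁ S₂ out x
... | _ | push₁ {t} {r} _         = shift x out ((t ∷ r) ++ S₂)
... | _ | push₂ {S₁} {u} {v} _ _  = shift-middle x out S₁ (u ∷ v)
... | _ | start₁ _                = shift x out S₂
... | _ | start₂ {t} {r} _        = shift-middle x out (t ∷ r) []
... | _ | bypass {t} {r} {u} {v} _ _ _ = begin
  (out ++ [ x ]) ++ (t ∷ r) ++ (u ∷ v) ≡⟨ ++-assoc out [ x ] _ ⟩
  out ++ x ∷ (t ∷ r) ++ (u ∷ v)        ↭⟨ shift x out _ ⟩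
  x ∷ out ++ (t ∷ r) ++ (u ∷ v)        ∎
  where open PermutationReasoning
... | _ | pop₁ {t} {r} {u} {v} _ _ _ _ = begin
  (out ++ t ∷ r) ++ x ∷ u ∷ v   ≡⟨ ++-assoc out (t ∷ r) _ ⟩
  out ++ (t ∷ r) ++ x ∷ u ∷ v   ↭⟨ shift-middle x out (t ∷ r) (u ∷ v) ⟩
  x ∷ out ++ (t ∷ r) ++ (u ∷ v) ∎
  where open PermutationReasoning
... | _ | pop₂ {t} {r} {u} {v} _ _ _ _ = begin
  (out ++ u ∷ v) ++ (t ∷ r) ++ [ x ]   ≡⟨ ++-assoc out (u ∷ v) _ ⟩
  out ++ (u ∷ v) ++ (t ∷ r) ++ [ x ]   ↭⟨ ++⁺ˡ out (shifts (u ∷ v) (t ∷ r)) ⟩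
  out ++ (t ∷ r) ++ (u ∷ v) ++ [ x ]   ≡⟨ cong (out ++_) (++-assoc (t ∷ r) (u ∷ v) [ x ]) ⟨
  out ++ ((t ∷ r) ++ (u ∷ v)) ++ [ x ] ≡⟨ ++-assoc out _ [ x ] ⟨
  (out ++ (t ∷ r) ++ (u ∷ v)) ++ [ x ] ↭⟨ ∷↭∷ʳ x _ ⟨
  x ∷ out ++ (t ∷ r) ++ (u ∷ v)        ∎
  where open PermutationReasoning

-- The stack invariant

disjoint⇒notBelowTop : ∀ {x S T} → (∀ {v} → v ∈ S → v ∈ T → ⊥) → suc x ∈ S → NotBelowTop x T
disjoint⇒notBelowTop {T = []}    _        _     = tt
disjoint⇒notBelowTop {T = _ ∷ _} disjoint x+1∈S refl = disjoint x+1∈S (here refl)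

module Sortability {n : ℕ} {π : List ℕ} (perm : IsPerm n π) where

  π-unique : Unique π
  π-unique = unique-resp-↭ (↭-sym perm) (Unique.map⁺ suc-injective (Unique.upTo⁺ n))

  ∈π⇒inRange : ∀ {v} → v ∈ π → InRange n v
  ∈π⇒inRange v∈π with ∈-map⁻ suc (∈-resp-↭ perm v∈π)
  ... | _ , i∈ , refl = s≤s z≤n , ∈-upTo⁻ i∈

  inRange⇒∈π : ∀ {v} → InRange n v → v ∈ π
  inRange⇒∈π {suc v} (_ , v<n) = ∈-resp-↭ (↭-sym perm) (∈-map⁺ suc (∈-upTo⁺ v<n))

  pos : ℕ → ℕ
  pos = position π

  PushOrder : List ℕ → Set
  PushOrder (a ∷ b ∷ r) = pos b < pos a × PushOrder (b ∷ r)
  PushOrder _           = ⊤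

  NoPredAfter : ℕ → ℕ → Set
  NoPredAfter k t = pos t < pos (pred t) → pos (pred t) < k → ⊥

  TopNoPredAfter : ℕ → List ℕ → Set
  TopNoPredAfter k []      = ⊤
  TopNoPredAfter k (t ∷ _) = NoPredAfter k t

  record StackInvariant (P S₁ S₂ out : List ℕ) : Set where
    field
      conserved    : out ++ S₁ ++ S₂ ↭ P
      consecutive₁ : Consecutive S₁
      consecutive₂ : Consecutive S₂
      pushOrder₁   : PushOrder S₁
      pushOrder₂   : PushOrder S₂
      top₁         : TopNoPredAfter (length P) S₁
      top₂         : TopNoPredAfter (length P) S₂

  Invariant : List ℕ → State → Set
  Invariant P s = StackInvariant P (State.s1 s) (State.s2 s) (State.out s)

  invariant-initial : Invariant [] initial
  invariant-initial = record
    { conserved = ↭-refl ; consecutive₁ = tt ; consecutive₂ = tt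
    ; pushOrder₁ = tt ; pushOrder₂ = tt ; top₁ = tt ; top₂ = tt }

  module Stacks {P S₁ S₂ out} (P-unique : Unique P) (inv : StackInvariant P S₁ S₂ out) where
    open StackInvariant inv

    ∈S₁⇒∈P : ∀ {v} → v ∈ S₁ → v ∈ P
    ∈S₁⇒∈P v∈ = ∈-resp-↭ conserved (∈-++⁺ʳ out (∈-++⁺ˡ v∈))

    ∈S₂⇒∈P : ∀ {v} → v ∈ S₂ → v ∈ P
    ∈S₂⇒∈P v∈ = ∈-resp-↭ conserved (∈-++⁺ʳ out (∈-++⁺ʳ S₁ v∈))

    stacks-disjoint : ∀ {v} → v ∈ S₁ → v ∈ S₂ → ⊥
    stacks-disjoint = unique-++⇒disjoint S₁
      (unique-++ʳ out (unique-resp-↭ (↭-sym conserved) P-unique))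

  module Reading {P x S} (π≡ : P ++ x ∷ S ≡ π) where

    unique : Unique (P ++ x ∷ S)
    unique = subst Unique (sym π≡) π-unique

    x∈π : x ∈ π
    x∈π = subst (x ∈_) π≡ (∈-++⁺ʳ P (here refl))

    ∈P⇒∈π : ∀ {v} → v ∈ P → v ∈ π
    ∈P⇒∈π v∈ = subst (_ ∈_) π≡ (∈-++⁺ˡ v∈)

    ∈S⇒∈π : ∀ {v} → v ∈ S → v ∈ π
    ∈S⇒∈π v∈ = subst (_ ∈_) π≡ (∈-++⁺ʳ P (there v∈))

    x∉P : x ∉ P
    x∉P x∈ = unique-++⇒disjoint P unique x∈ (here refl)

    ∈S⇒∉P : ∀ {v} → v ∈ S → v ∉ P
    ∈S⇒∉P v∈S v∈P = unique-++⇒disjoint P unique v∈P (there v∈S)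

    x∉S : x ∉ S
    x∉S x∈ = All.lookup (AllPairs.head (unique-++ʳ P unique)) x∈ refl

    pos-P : ∀ {v} → v ∈ P → pos v < length P
    pos-P v∈ = subst (λ L → position L _ < length P) π≡ (position-prefix v∈)

    pos-x : pos x ≡ length P
    pos-x = begin
      position π x             ≡⟨ cong (λ L → position L x) π≡ ⟨
      position (P ++ x ∷ S) x  ≡⟨ position-++ʳ x∉P ⟩
      length P + position (x ∷ S) x ≡⟨ cong (length P +_) position-here ⟩
      length P + 0             ≡⟨ +-identityʳ _ ⟩
      length P                 ∎
      where open ≡-Reasoning

    pos-S : ∀ {v} → v ∈ S → length P < pos v
    pos-S {v} v∈ = subst (length P <_) (sym eq) (m<m+n (length P) (s≤s z≤n))
      where
      open ≡-Reasoning
      eq : pos v ≡ length P + suc (position S v)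
      eq = begin
        position π v                   ≡⟨ cong (λ L → position L v) π≡ ⟨
        position (P ++ x ∷ S) v        ≡⟨ position-++ʳ (∈S⇒∉P v∈) ⟩
        length P + position (x ∷ S) v  ≡⟨ cong (length P +_) (position-there λ { refl → x∉S v∈ }) ⟩
        length P + suc (position S v)  ∎

    P-unique : Unique P
    P-unique = unique-++ˡ P unique

    length-read : length (P ++ [ x ]) ≡ suc (length P)
    length-read = trans (length-++ P) (+-comm (length P) 1)

    noPredAfter-read : ∀ {t} → t ∈ π → suc x ≢ t → NoPredAfter (length P) t → NoPredAfter (length (P ++ [ x ])) t
    noPredAfter-read {t} t∈π x+1≢t noPred t≺t-1 t-1≺ with pos (pred t) <? length P
    ... | yes early = noPred t≺t-1 early
    ... | no  late  = x+1≢t (trans (cong suc (sym t-1≡x)) (suc-pred t ⦃ >-nonZero (proj₁ (∈π⇒inRange t∈π)) ⦄))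
      where
      t-1≡x : pred t ≡ x
      t-1≡x = position-injective x∈π
        (trans (≤-antisym (≤-pred (subst (pos (pred t) <_) length-read t-1≺)) (≮⇒≥ late)) (sym pos-x))

    noPredAfter-new : NoPredAfter (length (P ++ [ x ])) x
    noPredAfter-new x≺x-1 x-1≺ =
      <-irrefl refl (≤-trans (subst (_< pos (pred x)) pos-x x≺x-1)
                             (≤-pred (subst (pos (pred x) <_) length-read x-1≺)))

    top-read : ∀ {L} → (∀ {v} → v ∈ L → v ∈ P) → NotBelowTop x L →
               TopNoPredAfter (length P) L → TopNoPredAfter (length (P ++ [ x ])) L
    top-read {[]}    _   _        _      = tt
    top-read {t ∷ _} ∈⇒ x+1≢t noPred = noPredAfter-read (∈P⇒∈π (∈⇒ (here refl))) x+1≢t noPred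

    invariant-step : ∀ {S₁ S₂ out} → StackInvariant P S₁ S₂ out → Invariant (P ++ [ x ]) (step (st S₁ S₂ out) x)
    invariant-step {S₁} {S₂} {out} inv = stacks-step (stepView S₁ S₂ out x) conserved′
      where
      open StackInvariant inv
      open Stacks P-unique inv

      conserved′ : let s = step (st S₁ S₂ out) x in State.out s ++ State.s1 s ++ State.s2 s ↭ P ++ [ x ]
      conserved′ = ↭-trans (step-rearranges S₁ S₂ out x) (↭-trans (prep x conserved) (∷↭∷ʳ x P))

      read-before-x : ∀ {v} → v ∈ P → pos v < pos x
      read-before-x v∈ = subst (pos _ <_) (sym pos-x) (pos-P v∈)

      keep₁ : NotBelowTop x S₁ → TopNoPredAfter (length (P ++ [ x ])) S₁
      keep₁ x≁S₁ = top-read ∈S₁⇒∈P x≁S₁ top₁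

      keep₂ : NotBelowTop x S₂ → TopNoPredAfter (length (P ++ [ x ])) S₂
      keep₂ x≁S₂ = top-read ∈S₂⇒∈P x≁S₂ top₂

      stacks-step : ∀ {s} → StepView out x S₁ S₂ s →
                    State.out s ++ State.s1 s ++ State.s2 s ↭ P ++ [ x ] → Invariant (P ++ [ x ]) s
      stacks-step (push₁ x+1≡t) c = record
        { conserved = c ; consecutive₁ = sym x+1≡t , consecutive₁ ; consecutive₂ = consecutive₂
        ; pushOrder₁ = read-before-x (∈S₁⇒∈P (here refl)) , pushOrder₁ ; pushOrder₂ = pushOrder₂
        ; top₁ = noPredAfter-new
        ; top₂ = keep₂ (disjoint⇒notBelowTop stacks-disjoint (subst (_∈ S₁) (sym x+1≡t) (here refl))) }
      stacks-step (push₂ x≁S₁ x+1≡u) c = record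
        { conserved = c ; consecutive₁ = consecutive₁ ; consecutive₂ = sym x+1≡u , consecutive₂
        ; pushOrder₁ = pushOrder₁ ; pushOrder₂ = read-before-x (∈S₂⇒∈P (here refl)) , pushOrder₂
        ; top₁ = keep₁ x≁S₁ ; top₂ = noPredAfter-new }
      stacks-step (start₁ x≁S₂) c = record
        { conserved = c ; consecutive₁ = tt ; consecutive₂ = consecutive₂
        ; pushOrder₁ = tt ; pushOrder₂ = pushOrder₂ ; top₁ = noPredAfter-new ; top₂ = keep₂ x≁S₂ }
      stacks-step (start₂ x≁S₁) c = record
        { conserved = c ; consecutive₁ = consecutive₁ ; consecutive₂ = tt
        ; pushOrder₁ = pushOrder₁ ; pushOrder₂ = tt ; top₁ = keep₁ x≁S₁ ; top₂ = noPredAfter-new }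
      stacks-step (bypass x≁S₁ x≁S₂ _) c = record
        { conserved = c ; consecutive₁ = consecutive₁ ; consecutive₂ = consecutive₂
        ; pushOrder₁ = pushOrder₁ ; pushOrder₂ = pushOrder₂ ; top₁ = keep₁ x≁S₁ ; top₂ = keep₂ x≁S₂ }
      stacks-step (pop₁ _ x≁S₂ _ _) c = record
        { conserved = c ; consecutive₁ = tt ; consecutive₂ = consecutive₂
        ; pushOrder₁ = tt ; pushOrder₂ = pushOrder₂ ; top₁ = noPredAfter-new ; top₂ = keep₂ x≁S₂ }
      stacks-step (pop₂ x≁S₁ _ _ _) c = record
        { conserved = c ; consecutive₁ = consecutive₁ ; consecutive₂ = tt
        ; pushOrder₁ = pushOrder₁ ; pushOrder₂ = tt ; top₁ = keep₁ x≁S₁ ; top₂ = noPredAfter-new }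

  invariant-run : ∀ Q {S} P s → P ++ Q ++ S ≡ π → Invariant P s → Invariant (P ++ Q) (run s Q)
  invariant-run []      P s _  inv = subst (λ L → Invariant L s) (sym (++-identityʳ P)) inv
  invariant-run (x ∷ Q) P s π≡ inv =
    subst (λ L → Invariant L (run (step s x) Q)) (++-assoc P [ x ] Q)
      (invariant-run Q (P ++ [ x ]) (step s x) (trans (++-assoc P [ x ] _) π≡) (Reading.invariant-step π≡ inv))

-- A sortable permutation avoids the basis

oneTo-sorted : ∀ n → AllPairs _<_ (oneTo n)
oneTo-sorted n = AllPairs.map⁺ (AllPairs.applyUpTo⁺₁ (λ i → i) n (λ i<j _ → s≤s i<j))

module SortedAvoids {n : ℕ} {π : List ℕ} (perm : IsPerm n π) where
  open Sortability perm

  stack-pred-above : ∀ {a r v} → Consecutive (a ∷ r) → PushOrder (a ∷ r) → v ∈ a ∷ r → a < v →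
                     pos v < pos (pred v) × pred v ∈ a ∷ r
  stack-pred-above _          _              (here refl)           a<a = ⊥-elim (<-irrefl refl a<a)
  stack-pred-above (refl , _) (later , _)    (there (here refl))   _   = later , here refl
  stack-pred-above {r = b ∷ r} (refl , c) (_ , po) (there (there v∈)) _ =
    let later , v-1∈ = stack-pred-above c po (there v∈) (consecutive-tail< c v∈) in later , there v-1∈
    where
    consecutive-tail< : ∀ {b r v} → Consecutive (b ∷ r) → v ∈ r → b < v
    consecutive-tail< {r = _ ∷ _} (refl , c) v∈ = consecutive-head≤ c v∈

  stacked-above⇒¬noPredAfter : ∀ {L v v′ k} → Consecutive L → PushOrder L → v ∈ L → v′ ∈ L → v < v′ →
                               (∀ {z} → z ∈ L → pos z < k) → ¬ NoPredAfter k v′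
  stacked-above⇒¬noPredAfter {a ∷ r} c po v∈ v′∈ v<v′ read noPred =
    let later , v′-1∈ = stack-pred-above c po v′∈ (≤-<-trans (consecutive-head≤ c v∈) v<v′)
    in noPred later (read v′-1∈)

  record ThreeWaiting : Set where
    field
      P S          : List ℕ
      π≡           : P ++ S ≡ π
      w v₁ v₂ v₃   : ℕ
      w∈S          : w ∈ S
      v₁∈P         : v₁ ∈ P
      v₂∈P         : v₂ ∈ P
      v₃∈P         : v₃ ∈ P
      w<v₁         : w < v₁
      v₁<v₂        : v₁ < v₂
      v₂<v₃        : v₂ < v₃
      waiting₁     : NoPredAfter (length P) v₁
      waiting₂     : NoPredAfter (length P) v₂
      waiting₃     : NoPredAfter (length P) v₃

  module AfterPrefix {P S} (π≡ : P ++ S ≡ π) where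
    state : State
    state = run initial P

    invariant : Invariant P state
    invariant = invariant-run P {S} [] initial π≡ invariant-initial

    open StackInvariant invariant

    read : ∀ {v} → v ∈ State.s1 state ++ State.s2 state → pos v < length P
    read v∈ = subst (λ L → position L _ < length P) π≡
                (position-prefix (∈-resp-↭ conserved (∈-++⁺ʳ (State.out state) v∈)))

    sorted⇒stacked : SortedByPSBP π n → ∀ {w v} → w ∈ S → v ∈ P → w < v →
                     v ∈ State.s1 state ⊎ v ∈ State.s2 state
    sorted⇒stacked sorted {w} {v} w∈S v∈P w<v with finish∘run-extends state S
    ... | R , R≡ = held
      where
      out : List ℕ
      out = State.out state
      output≡ : oneTo n ≡ out ++ R
      output≡ = trans (sym sorted) (trans (cong (λ L → finish (run initial L)) (sym π≡))
                  (trans (cong finish (run-++ initial P S)) R≡))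
      increasing : AllPairs _<_ (out ++ R)
      increasing = subst (AllPairs _<_) output≡ (oneTo-sorted n)
      w∉P : w ∉ P
      w∉P w∈P = unique-++⇒disjoint P (subst Unique (sym π≡) π-unique) w∈P w∈S
      w∈R : w ∈ R
      w∈R with ∈-++⁻ out (subst (w ∈_) output≡ (∈-resp-↭ perm (subst (w ∈_) π≡ (∈-++⁺ʳ P w∈S))))
      ... | inj₂ w∈R = w∈R
      ... | inj₁ w∈out = ⊥-elim (w∉P (∈-resp-↭ conserved (∈-++⁺ˡ w∈out)))
      held : v ∈ State.s1 state ⊎ v ∈ State.s2 state
      held with ∈-++⁻ out (∈-resp-↭ (↭-sym conserved) v∈P)
      ... | inj₁ v∈out = ⊥-elim (<-asym (allPairs-++⇒ out increasing v∈out w∈R) w<v)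
      ... | inj₂ v∈stacks = ∈-++⁻ (State.s1 state) v∈stacks

  -- When w is read all three are still on the two stacks, so two share a stack,
  -- where only the top can be waiting.
  threeWaiting⇒unsorted : SortedByPSBP π n → ThreeWaiting → ⊥
  threeWaiting⇒unsorted sorted tw =
    pigeonhole (stacked v₁∈P ≤-refl) (stacked v₂∈P (<⇒≤ v₁<v₂)) (stacked v₃∈P (<⇒≤ v₁<v₃))
    where
    open ThreeWaiting tw
    open AfterPrefix {P} {S} π≡
    open StackInvariant invariant
    S₁ S₂ : List ℕ
    S₁ = State.s1 state
    S₂ = State.s2 state
    v₁<v₃ : v₁ < v₃
    v₁<v₃ = <-trans v₁<v₂ v₂<v₃
    stacked : ∀ {v} → v ∈ P → v₁ ≤ v → v ∈ S₁ ⊎ v ∈ S₂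
    stacked v∈P v₁≤v = sorted⇒stacked sorted w∈S v∈P (<-≤-trans w<v₁ v₁≤v)
    same₁ : ∀ {v v′} → v ∈ S₁ → v′ ∈ S₁ → v < v′ → ¬ NoPredAfter (length P) v′
    same₁ v∈ v′∈ v<v′ = stacked-above⇒¬noPredAfter consecutive₁ pushOrder₁ v∈ v′∈ v<v′ (λ z∈ → read (∈-++⁺ˡ z∈))
    same₂ : ∀ {v v′} → v ∈ S₂ → v′ ∈ S₂ → v < v′ → ¬ NoPredAfter (length P) v′
    same₂ v∈ v′∈ v<v′ = stacked-above⇒¬noPredAfter consecutive₂ pushOrder₂ v∈ v′∈ v<v′ (λ z∈ → read (∈-++⁺ʳ S₁ z∈))
    pigeonhole : v₁ ∈ S₁ ⊎ v₁ ∈ S₂ → v₂ ∈ S₁ ⊎ v₂ ∈ S₂ → v₃ ∈ S₁ ⊎ v₃ ∈ S₂ → ⊥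
    pigeonhole (inj₁ a) (inj₁ b) _        = same₁ a b v₁<v₂ waiting₂
    pigeonhole (inj₂ a) (inj₂ b) _        = same₂ a b v₁<v₂ waiting₂
    pigeonhole (inj₁ a) (inj₂ b) (inj₁ c) = same₁ a c v₁<v₃ waiting₃
    pigeonhole (inj₁ a) (inj₂ b) (inj₂ c) = same₂ b c v₂<v₃ waiting₃
    pigeonhole (inj₂ a) (inj₁ b) (inj₁ c) = same₁ b c v₂<v₃ waiting₃
    pigeonhole (inj₂ a) (inj₁ b) (inj₂ c) = same₂ a c v₁<v₃ waiting₃

  record LeavesWaiting (k z y : ℕ) : Set where
    constructor leaves
    field
      y∈π    : y ∈ π
      y-read : pos y < k
      z<y    : z < y
      z-gap  : k ≤ pos z ⊎ pos z < pos y

  record WaitingIn (k z y : ℕ) : Set where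
    field
      value   : ℕ
      above   : z < value
      atMost  : value ≤ y
      ∈π      : value ∈ π
      read    : pos value < k
      waiting : NoPredAfter k value

  -- Follow y, y − 1, y − 2, ... while each is read after the previous one and
  -- before time k; the chain cannot pass z, which is read too early or too late.
  leavesWaiting⇒waitingIn : ∀ {k z y} → k ≤ length π → LeavesWaiting k z y → WaitingIn k z y
  leavesWaiting⇒waitingIn {k} {z} {suc y′} k≤ (leaves y∈π y-read z<y z-gap)
    with pos (suc y′) <? pos y′ | pos y′ <? k
  ... | no  y′-earlier | _ = record
    { value = suc y′ ; above = z<y ; atMost = ≤-refl ; ∈π = y∈π ; read = y-read
    ; waiting = λ later _ → y′-earlier later }
  ... | yes _ | no y′-unread = record
    { value = suc y′ ; above = z<y ; atMost = ≤-refl ; ∈π = y∈π ; read = y-read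
    ; waiting = λ _ read → y′-unread read }
  ... | yes y′-later | yes y′-read = record
    { value = value ; above = above ; atMost = m≤n⇒m≤1+n atMost ; ∈π = ∈π ; read = read ; waiting = waiting }
    where
    z≢y′ : ∀ {z} → k ≤ pos z ⊎ pos z < pos (suc y′) → z ≢ y′
    z≢y′ (inj₁ late)  refl = <⇒≱ y′-read late
    z≢y′ (inj₂ early) refl = <-asym early y′-later
    gap′ : ∀ {z} → k ≤ pos z ⊎ pos z < pos (suc y′) → k ≤ pos z ⊎ pos z < pos y′
    gap′ (inj₁ late)  = inj₁ late
    gap′ (inj₂ early) = inj₂ (<-trans early y′-later)
    open WaitingIn (leavesWaiting⇒waitingIn k≤
      (leaves (position<length⇒∈ (<-≤-trans y′-read k≤)) y′-read (≤∧≢⇒< (≤-pred z<y) (z≢y′ z-gap)) (gap′ z-gap)))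

  threeWaiting-from : ∀ {k w z₁ y₁ z₂ y₂ z₃ y₃} → k ≤ length π → w ∈ π → k ≤ pos w →
                      w ≤ z₁ → y₁ ≤ z₂ → y₂ ≤ z₃ →
                      LeavesWaiting k z₁ y₁ → LeavesWaiting k z₂ y₂ → LeavesWaiting k z₃ y₃ → ThreeWaiting
  threeWaiting-from {k} {w} k≤ w∈π w-unread w≤z₁ y₁≤z₂ y₂≤z₃ l₁ l₂ l₃ = record
    { P = take k π ; S = drop k π ; π≡ = take++drop≡id k π
    ; w = w ; v₁ = W₁.value ; v₂ = W₂.value ; v₃ = W₃.value
    ; w∈S = ∈-drop w∈π w-unread
    ; v₁∈P = ∈-take W₁.∈π W₁.read ; v₂∈P = ∈-take W₂.∈π W₂.read ; v₃∈P = ∈-take W₃.∈π W₃.read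
    ; w<v₁ = ≤-<-trans w≤z₁ W₁.above
    ; v₁<v₂ = ≤-<-trans (≤-trans W₁.atMost y₁≤z₂) W₂.above
    ; v₂<v₃ = ≤-<-trans (≤-trans W₂.atMost y₂≤z₃) W₃.above
    ; waiting₁ = at-prefix W₁.waiting ; waiting₂ = at-prefix W₂.waiting ; waiting₃ = at-prefix W₃.waiting }
    where
    module W₁ = WaitingIn (leavesWaiting⇒waitingIn k≤ l₁)
    module W₂ = WaitingIn (leavesWaiting⇒waitingIn k≤ l₂)
    module W₃ = WaitingIn (leavesWaiting⇒waitingIn k≤ l₃)
    at-prefix : ∀ {v} → NoPredAfter k v → NoPredAfter (length (take k π)) v
    at-prefix {v} = subst (λ m → NoPredAfter m v) (sym (trans (length-take k π) (m≤n⇒m⊓n≡m k≤)))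

  -- Entries of an occurrence, addressed by their index in the pattern; the side
  -- conditions are decided by evaluation once the pattern is a literal.
  module Entries {ρ} (o : Occurrence π ρ) where
    open Occurrence o

    e : ℕ → ℕ
    e = entry

    mem : ∀ i {_ : True (i <? length ρ)} → e i ∈ π
    mem i {i<} = entry∈ (toWitness i<)

    prec : ∀ i j {_ : True (i <? j)} {_ : True (j <? length ρ)} → pos (e i) < pos (e j)
    prec i j {i<j} {j<} = entry-precedes (toWitness i<j) (toWitness j<)

    smaller : ∀ i j {_ : True (i <? length ρ)} {_ : True (j <? length ρ)} {_ : True (nth ρ i <? nth ρ j)} →
              e i < e j
    smaller i j {i<} {j<} {lt} = entry-ordered (toWitness i<) (toWitness j<) (toWitness lt)

    -- In every basis pattern the cut falls right after the third entry.
    cut : ℕ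
    cut = suc (pos (e 2))

    cut≤ : {_ : True (2 <? length ρ)} → cut ≤ length π
    cut≤ {2<} = position<length (mem 2 {2<})

    read : ∀ i {_ : True (i <? 2)} {_ : True (2 <? length ρ)} → pos (e i) < cut
    read i {i<2} {2<} = m<n⇒m<1+n (prec i 2 {i<2} {2<})

    read₂ : pos (e 2) < cut
    read₂ = n<1+n _

    unread : ∀ i {_ : True (2 <? i)} {_ : True (i <? length ρ)} → cut ≤ pos (e i)
    unread i {2<i} {i<} = prec 2 i {2<i} {i<}

  contains2341⇒threeWaiting : Contains π (2 ∷ 3 ∷ 4 ∷ 1 ∷ []) → ThreeWaiting
  contains2341⇒threeWaiting c = threeWaiting-from cut≤ (mem 3) (unread 3) ≤-refl ≤-refl ≤-refl
    (leaves (mem 0) (read 0) (smaller 3 0) (inj₁ (unread 3)))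
    (leaves (mem 1) (read 1) (smaller 0 1) (inj₂ (prec 0 1)))
    (leaves (mem 2) read₂    (smaller 1 2) (inj₂ (prec 1 2)))
    where open Entries (contains⇒occurrence π-unique c)

  contains25314⇒threeWaiting : Contains π (2 ∷ 5 ∷ 3 ∷ 1 ∷ 4 ∷ []) → ThreeWaiting
  contains25314⇒threeWaiting c = threeWaiting-from cut≤ (mem 3) (unread 3) ≤-refl ≤-refl (<⇒≤ (smaller 2 4))
    (leaves (mem 0) (read 0) (smaller 3 0) (inj₁ (unread 3)))
    (leaves (mem 2) read₂    (smaller 0 2) (inj₂ (prec 0 2)))
    (leaves (mem 1) (read 1) (smaller 4 1) (inj₁ (unread 4)))
    where open Entries (contains⇒occurrence π-unique c)

  contains42513⇒threeWaiting : Contains π (4 ∷ 2 ∷ 5 ∷ 1 ∷ 3 ∷ []) → ThreeWaiting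
  contains42513⇒threeWaiting c = threeWaiting-from cut≤ (mem 3) (unread 3) ≤-refl (<⇒≤ (smaller 1 4)) ≤-refl
    (leaves (mem 1) (read 1) (smaller 3 1) (inj₁ (unread 3)))
    (leaves (mem 0) (read 0) (smaller 4 0) (inj₁ (unread 4)))
    (leaves (mem 2) read₂    (smaller 0 2) (inj₂ (prec 0 2)))
    where open Entries (contains⇒occurrence π-unique c)

  contains42531⇒threeWaiting : Contains π (4 ∷ 2 ∷ 5 ∷ 3 ∷ 1 ∷ []) → ThreeWaiting
  contains42531⇒threeWaiting c = threeWaiting-from cut≤ (mem 4) (unread 4) ≤-refl (<⇒≤ (smaller 1 3)) ≤-refl
    (leaves (mem 1) (read 1) (smaller 4 1) (inj₁ (unread 4)))
    (leaves (mem 0) (read 0) (smaller 3 0) (inj₁ (unread 3)))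
    (leaves (mem 2) read₂    (smaller 0 2) (inj₂ (prec 0 2)))
    where open Entries (contains⇒occurrence π-unique c)

  contains45213⇒threeWaiting : Contains π (4 ∷ 5 ∷ 2 ∷ 1 ∷ 3 ∷ []) → ThreeWaiting
  contains45213⇒threeWaiting c = threeWaiting-from cut≤ (mem 3) (unread 3) ≤-refl (<⇒≤ (smaller 2 4)) ≤-refl
    (leaves (mem 2) read₂    (smaller 3 2) (inj₁ (unread 3)))
    (leaves (mem 0) (read 0) (smaller 4 0) (inj₁ (unread 4)))
    (leaves (mem 1) (read 1) (smaller 0 1) (inj₂ (prec 0 1)))
    where open Entries (contains⇒occurrence π-unique c)

  contains45231⇒threeWaiting : Contains π (4 ∷ 5 ∷ 2 ∷ 3 ∷ 1 ∷ []) → ThreeWaiting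
  contains45231⇒threeWaiting c = threeWaiting-from cut≤ (mem 4) (unread 4) ≤-refl (<⇒≤ (smaller 2 3)) ≤-refl
    (leaves (mem 2) read₂    (smaller 4 2) (inj₁ (unread 4)))
    (leaves (mem 0) (read 0) (smaller 3 0) (inj₁ (unread 3)))
    (leaves (mem 1) (read 1) (smaller 0 1) (inj₂ (prec 0 1)))
    where open Entries (contains⇒occurrence π-unique c)

  contains52314⇒threeWaiting : Contains π (5 ∷ 2 ∷ 3 ∷ 1 ∷ 4 ∷ []) → ThreeWaiting
  contains52314⇒threeWaiting c = threeWaiting-from cut≤ (mem 3) (unread 3) ≤-refl ≤-refl (<⇒≤ (smaller 2 4))
    (leaves (mem 1) (read 1) (smaller 3 1) (inj₁ (unread 3)))
    (leaves (mem 2) read₂    (smaller 1 2) (inj₂ (prec 1 2)))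
    (leaves (mem 0) (read 0) (smaller 4 0) (inj₁ (unread 4)))
    where open Entries (contains⇒occurrence π-unique c)

  contains642135⇒threeWaiting : Contains π (6 ∷ 4 ∷ 2 ∷ 1 ∷ 3 ∷ 5 ∷ []) → ThreeWaiting
  contains642135⇒threeWaiting c =
    threeWaiting-from cut≤ (mem 3) (unread 3) ≤-refl (<⇒≤ (smaller 2 4)) (<⇒≤ (smaller 1 5))
    (leaves (mem 2) read₂    (smaller 3 2) (inj₁ (unread 3)))
    (leaves (mem 1) (read 1) (smaller 4 1) (inj₁ (unread 4)))
    (leaves (mem 0) (read 0) (smaller 5 0) (inj₁ (unread 5)))
    where open Entries (contains⇒occurrence π-unique c)

  contains642153⇒threeWaiting : Contains π (6 ∷ 4 ∷ 2 ∷ 1 ∷ 5 ∷ 3 ∷ []) → ThreeWaiting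
  contains642153⇒threeWaiting c =
    threeWaiting-from cut≤ (mem 3) (unread 3) ≤-refl (<⇒≤ (smaller 2 5)) (<⇒≤ (smaller 1 4))
    (leaves (mem 2) read₂    (smaller 3 2) (inj₁ (unread 3)))
    (leaves (mem 1) (read 1) (smaller 5 1) (inj₁ (unread 5)))
    (leaves (mem 0) (read 0) (smaller 4 0) (inj₁ (unread 4)))
    where open Entries (contains⇒occurrence π-unique c)

  sorted⇒avoids : SortedByPSBP π n → Av basis π
  sorted⇒avoids sorted =
      avoid contains2341⇒threeWaiting  ∷ avoid contains25314⇒threeWaiting ∷ avoid contains42513⇒threeWaiting
    ∷ avoid contains42531⇒threeWaiting ∷ avoid contains45213⇒threeWaiting ∷ avoid contains45231⇒threeWaiting
    ∷ avoid contains52314⇒threeWaiting ∷ avoid contains642135⇒threeWaiting ∷ avoid contains642153⇒threeWaiting ∷ []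
    where
    avoid : ∀ {ρ} → (Contains π ρ → ThreeWaiting) → Avoids π ρ
    avoid found c = threeWaiting⇒unsorted sorted (found c)

-- A permutation avoiding the basis is sortable

below-both-tops : ∀ {t u x} → x < (t ∸ 1) ⊓ (u ∸ 1) → x < t × x < u
below-both-tops {t} {u} lt =
  ≤-trans lt (≤-trans (m⊓n≤m _ _) (m∸n≤m t 1)) , ≤-trans lt (≤-trans (m⊓n≤n _ _) (m∸n≤m u 1))

popped-top< : ∀ {t u x} → 1 ≤ t → t ≤ u → ¬ x < (t ∸ 1) ⊓ (u ∸ 1) → suc x ≢ t → x ≢ t → t < x
popped-top< {suc t} {u} {x} _ t≤u ¬bypass x+1≢t x≢t = ≤∧≢⇒< (≤∧≢⇒< t≤x (λ { refl → x+1≢t refl })) (x≢t ∘ sym)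
  where
  t≤x : t ≤ x
  t≤x = subst (_≤ x) (m≤n⇒m⊓n≡m (∸-monoˡ-≤ 1 t≤u)) (≮⇒≥ ¬bypass)

pred< : ∀ {v y} → y < v → pred v < v
pred< {suc v} _ = n<1+n v

below-pred : ∀ {x v} → x < v → suc x ≢ v → x < pred v
below-pred {x} {suc v} x<v x+1≢v = ≤∧≢⇒< (≤-pred x<v) λ { refl → x+1≢v refl }

module AvoidsSorted {n : ℕ} {π : List ℕ} (perm : IsPerm n π) where
  open Sortability perm

  -- PSBP is about to read x while y, smaller than x and both stack tops t and u, is still unread.
  record Stuck : Set where
    field
      P S         : List ℕ
      x t u y     : ℕ
      π≡          : P ++ x ∷ S ≡ π
      t∈P         : t ∈ P
      u∈P         : u ∈ P
      y∈S         : y ∈ S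
      t≢u         : t ≢ u
      y<t         : y < t
      y<u         : y < u
      y<x         : y < x
      x+1≢t       : suc x ≢ t
      x+1≢u       : suc x ≢ u
      waiting-t   : NoPredAfter (length P) t
      waiting-u   : NoPredAfter (length P) u

  Pending : List ℕ → List ℕ → List ℕ → ℕ → Set
  Pending S₁ S₂ S b = b ∈ S₁ ⊎ b ∈ S₂ ⊎ b ∈ S

  record SortedSoFar (S₁ S₂ out S : List ℕ) : Set where
    field
      increasing    : AllPairs _<_ out
      below-pending : ∀ {a b} → a ∈ out → Pending S₁ S₂ S b → a < b

  SortedSoFarₛ : State → List ℕ → Set
  SortedSoFarₛ s S = SortedSoFar (State.s1 s) (State.s2 s) (State.out s) S

  pending-shrinks : ∀ {S₁ S₂ S S₁′ S₂′ S′ out} → (∀ {b} → Pending S₁′ S₂′ S′ b → Pending S₁ S₂ S b) →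
                    SortedSoFar S₁ S₂ out S → SortedSoFar S₁′ S₂′ out S′
  pending-shrinks shrink sorted =
    record { increasing = increasing ; below-pending = λ a∈ b∈ → below-pending a∈ (shrink b∈) }
    where open SortedSoFar sorted

  emit : ∀ {S₁ S₂ S S₁′ S₂′ S′ out B} → SortedSoFar S₁ S₂ out S → AllPairs _<_ B →
         (∀ {b} → b ∈ B → Pending S₁ S₂ S b) →
         (∀ {b} → Pending S₁′ S₂′ S′ b → Pending S₁ S₂ S b) →
         (∀ {a b} → a ∈ B → Pending S₁′ S₂′ S′ b → a < b) →
         SortedSoFar S₁′ S₂′ (out ++ B) S′
  emit {S₁′ = S₁′} {S₂′} {S′} {out} {B} sorted B↑ B-pending shrink B-below = record
    { increasing    = AllPairs.++⁺ increasing B↑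
                        (All.tabulate λ a∈ → All.tabulate λ b∈ → below-pending a∈ (B-pending b∈))
    ; below-pending = below }
    where
    open SortedSoFar sorted
    below : ∀ {a b} → a ∈ out ++ B → Pending S₁′ S₂′ S′ b → a < b
    below a∈ b∈ with ∈-++⁻ out a∈
    ... | inj₁ a∈out = below-pending a∈out (shrink b∈)
    ... | inj₂ a∈B   = B-below a∈B b∈

  module Step {P x S} (π≡ : P ++ x ∷ S ≡ π) where
    open Reading π≡

    unread-below? : ∀ m → (Σ ℕ λ y → y ∈ S × y < m) ⊎ (∀ {b} → b ∈ S → m ≤ b)
    unread-below? m with any? (_<? m) S
    ... | yes some = inj₁ (find some)
    ... | no  none = inj₂ λ b∈ → ≮⇒≥ (All.lookup (¬Any⇒All¬ S none) b∈)

    popped-below : ∀ {t r U} → Consecutive (t ∷ r) → (∀ {a} → a ∈ t ∷ r → a ∈ P) →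
                   (∀ {b} → b ∈ U → t < b × b ∉ t ∷ r) → t < x → (∀ {b} → b ∈ S → t ≤ b) →
                   ∀ {a b} → a ∈ t ∷ r → b ≡ x ⊎ b ∈ U ⊎ b ∈ S → a < b
    popped-below c ⊆P U-above t<x S-above a∈ (inj₁ refl) =
      consecutive-below c a∈ (x∉P ∘ ⊆P) t<x
    popped-below c ⊆P U-above t<x S-above a∈ (inj₂ (inj₁ b∈U)) =
      consecutive-below c a∈ (proj₂ (U-above b∈U)) (proj₁ (U-above b∈U))
    popped-below c ⊆P U-above t<x S-above a∈ (inj₂ (inj₂ b∈S)) =
      consecutive-below c a∈ (∈S⇒∉P b∈S ∘ ⊆P) (≤∧≢⇒< (S-above b∈S) λ { refl → ∈S⇒∉P b∈S (⊆P (here refl)) })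

    module Tops {t r u v out} (inv : StackInvariant P (t ∷ r) (u ∷ v) out) where
      open StackInvariant inv
      open Stacks P-unique inv

      t≢u : t ≢ u
      t≢u refl = stacks-disjoint (here refl) (here refl)

      stuck : ∀ {y} → y ∈ S → y < t → y < u → y < x → suc x ≢ t → suc x ≢ u → Stuck
      stuck {y} y∈S y<t y<u y<x x+1≢t x+1≢u = record
        { P = P ; S = S ; x = x ; t = t ; u = u ; y = y ; π≡ = π≡
        ; t∈P = ∈S₁⇒∈P (here refl) ; u∈P = ∈S₂⇒∈P (here refl) ; y∈S = y∈S ; t≢u = t≢u
        ; y<t = y<t ; y<u = y<u ; y<x = y<x ; x+1≢t = x+1≢t ; x+1≢u = x+1≢u
        ; waiting-t = top₁ ; waiting-u = top₂ }

      t<x : t ≤ u → ¬ x < (t ∸ 1) ⊓ (u ∸ 1) → suc x ≢ t → t < x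
      t<x t≤u ¬bypass x+1≢t = popped-top< (proj₁ (∈π⇒inRange (∈P⇒∈π (∈S₁⇒∈P (here refl))))) t≤u ¬bypass x+1≢t
        λ { refl → x∉P (∈S₁⇒∈P (here refl)) }

      u<x : u ≤ t → ¬ x < (t ∸ 1) ⊓ (u ∸ 1) → suc x ≢ u → u < x
      u<x u≤t ¬bypass x+1≢u = popped-top< (proj₁ (∈π⇒inRange (∈P⇒∈π (∈S₂⇒∈P (here refl))))) u≤t
        (¬bypass ∘ subst (x <_) (⊓-comm (u ∸ 1) (t ∸ 1))) x+1≢u λ { refl → x∉P (∈S₂⇒∈P (here refl)) }

      bypass-step : SortedSoFar (t ∷ r) (u ∷ v) out (x ∷ S) → suc x ≢ t → suc x ≢ u → x < (t ∸ 1) ⊓ (u ∸ 1) →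
                    SortedSoFar (t ∷ r) (u ∷ v) (out ++ [ x ]) S ⊎ Stuck
      bypass-step sorted x+1≢t x+1≢u x<tops with below-both-tops {t} {u} x<tops | unread-below? x
      ... | x<t , x<u | inj₁ (y , y∈S , y<x) = inj₂ (stuck y∈S (<-trans y<x x<t) (<-trans y<x x<u) y<x x+1≢t x+1≢u)
      ... | x<t , x<u | inj₂ S-above =
        inj₁ (emit sorted ([] ∷ []) (λ { (here refl) → inj₂ (inj₂ (here refl)) }) shrink x-below)
        where
        shrink : ∀ {b} → Pending (t ∷ r) (u ∷ v) S b → Pending (t ∷ r) (u ∷ v) (x ∷ S) b
        shrink (inj₁ b∈)         = inj₁ b∈
        shrink (inj₂ (inj₁ b∈))  = inj₂ (inj₁ b∈)
        shrink (inj₂ (inj₂ b∈))  = inj₂ (inj₂ (there b∈))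
        x-below : ∀ {a b} → a ∈ [ x ] → Pending (t ∷ r) (u ∷ v) S b → a < b
        x-below (here refl) (inj₁ b∈)        = <-≤-trans x<t (consecutive-head≤ consecutive₁ b∈)
        x-below (here refl) (inj₂ (inj₁ b∈)) = <-≤-trans x<u (consecutive-head≤ consecutive₂ b∈)
        x-below (here refl) (inj₂ (inj₂ b∈)) = ≤∧≢⇒< (S-above b∈) λ { refl → x∉S b∈ }

      pop₁-step : SortedSoFar (t ∷ r) (u ∷ v) out (x ∷ S) → suc x ≢ t → suc x ≢ u →
                  ¬ x < (t ∸ 1) ⊓ (u ∸ 1) → t < u →
                  SortedSoFar (x ∷ []) (u ∷ v) (out ++ t ∷ r) S ⊎ Stuck
      pop₁-step sorted x+1≢t x+1≢u ¬bypass t<u with unread-below? t | t<x (<⇒≤ t<u) ¬bypass x+1≢t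
      ... | inj₁ (y , y∈S , y<t) | t<x = inj₂ (stuck y∈S y<t (<-trans y<t t<u) (<-trans y<t t<x) x+1≢t x+1≢u)
      ... | inj₂ S-above | t<x = inj₁ (emit sorted (consecutive⇒sorted consecutive₁) inj₁ shrink
                                   λ a∈ b∈ → popped-below consecutive₁ ∈S₁⇒∈P u∷v-above t<x S-above a∈ (reshape b∈))
        where
        shrink : ∀ {b} → Pending (x ∷ []) (u ∷ v) S b → Pending (t ∷ r) (u ∷ v) (x ∷ S) b
        shrink (inj₁ (here refl)) = inj₂ (inj₂ (here refl))
        shrink (inj₂ (inj₁ b∈))   = inj₂ (inj₁ b∈)
        shrink (inj₂ (inj₂ b∈))   = inj₂ (inj₂ (there b∈))
        reshape : ∀ {b} → Pending (x ∷ []) (u ∷ v) S b → b ≡ x ⊎ b ∈ u ∷ v ⊎ b ∈ S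
        reshape (inj₁ (here refl)) = inj₁ refl
        reshape (inj₂ b∈)          = inj₂ b∈
        u∷v-above : ∀ {b} → b ∈ u ∷ v → t < b × b ∉ t ∷ r
        u∷v-above b∈ = <-≤-trans t<u (consecutive-head≤ consecutive₂ b∈) , λ b∈′ → stacks-disjoint b∈′ b∈

      pop₂-step : SortedSoFar (t ∷ r) (u ∷ v) out (x ∷ S) → suc x ≢ t → suc x ≢ u →
                  ¬ x < (t ∸ 1) ⊓ (u ∸ 1) → ¬ t < u →
                  SortedSoFar (t ∷ r) (x ∷ []) (out ++ u ∷ v) S ⊎ Stuck
      pop₂-step sorted x+1≢t x+1≢u ¬bypass t≮u with ≤∧≢⇒< (≮⇒≥ t≮u) (t≢u ∘ sym)
      ... | u<t with unread-below? u | u<x (<⇒≤ u<t) ¬bypass x+1≢u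
      ...   | inj₁ (y , y∈S , y<u) | u<x = inj₂ (stuck y∈S (<-trans y<u u<t) y<u (<-trans y<u u<x) x+1≢t x+1≢u)
      ...   | inj₂ S-above | u<x = inj₁ (emit sorted (consecutive⇒sorted consecutive₂) (inj₂ ∘ inj₁) shrink
                                   λ a∈ b∈ → popped-below consecutive₂ ∈S₂⇒∈P t∷r-above u<x S-above a∈ (reshape b∈))
        where
        shrink : ∀ {b} → Pending (t ∷ r) (x ∷ []) S b → Pending (t ∷ r) (u ∷ v) (x ∷ S) b
        shrink (inj₁ b∈)                 = inj₁ b∈
        shrink (inj₂ (inj₁ (here refl))) = inj₂ (inj₂ (here refl))
        shrink (inj₂ (inj₂ b∈))          = inj₂ (inj₂ (there b∈))
        reshape : ∀ {b} → Pending (t ∷ r) (x ∷ []) S b → b ≡ x ⊎ b ∈ t ∷ r ⊎ b ∈ S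
        reshape (inj₁ b∈)                 = inj₂ (inj₁ b∈)
        reshape (inj₂ (inj₁ (here refl))) = inj₁ refl
        reshape (inj₂ (inj₂ b∈))          = inj₂ (inj₂ b∈)
        t∷r-above : ∀ {b} → b ∈ t ∷ r → u < b × b ∉ u ∷ v
        t∷r-above b∈ = <-≤-trans u<t (consecutive-head≤ consecutive₁ b∈) , λ b∈′ → stacks-disjoint b∈ b∈′

    pushed₁ : ∀ {S₁ S₂ b} → Pending (x ∷ S₁) S₂ S b → Pending S₁ S₂ (x ∷ S) b
    pushed₁ (inj₁ (here refl)) = inj₂ (inj₂ (here refl))
    pushed₁ (inj₁ (there b∈))  = inj₁ b∈
    pushed₁ (inj₂ (inj₁ b∈))   = inj₂ (inj₁ b∈)
    pushed₁ (inj₂ (inj₂ b∈))   = inj₂ (inj₂ (there b∈))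

    pushed₂ : ∀ {S₁ S₂ b} → Pending S₁ (x ∷ S₂) S b → Pending S₁ S₂ (x ∷ S) b
    pushed₂ (inj₁ b∈)                 = inj₁ b∈
    pushed₂ (inj₂ (inj₁ (here refl))) = inj₂ (inj₂ (here refl))
    pushed₂ (inj₂ (inj₁ (there b∈)))  = inj₂ (inj₁ b∈)
    pushed₂ (inj₂ (inj₂ b∈))          = inj₂ (inj₂ (there b∈))

    sortedSoFar-step : ∀ {S₁ S₂ out} → StackInvariant P S₁ S₂ out → SortedSoFar S₁ S₂ out (x ∷ S) →
                       SortedSoFarₛ (step (st S₁ S₂ out) x) S ⊎ Stuck
    sortedSoFar-step {S₁} {S₂} {out} inv sorted with step (st S₁ S₂ out) x | stepView S₁ S₂ out x
    ... | _ | push₁ _         = inj₁ (pending-shrinks pushed₁ sorted)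
    ... | _ | push₂ _ _       = inj₁ (pending-shrinks pushed₂ sorted)
    ... | _ | start₁ _        = inj₁ (pending-shrinks pushed₁ sorted)
    ... | _ | start₂ _        = inj₁ (pending-shrinks pushed₂ sorted)
    ... | _ | bypass a b c    = Tops.bypass-step inv sorted a b c
    ... | _ | pop₁ a b c d    = Tops.pop₁-step inv sorted a b c d
    ... | _ | pop₂ a b c d    = Tops.pop₂-step inv sorted a b c d

  flush : ∀ {S₁ S₂ out B} → SortedSoFar S₁ S₂ out [] → AllPairs _<_ B →
          (∀ {b} → b ∈ B → Pending S₁ S₂ [] b) → AllPairs _<_ (out ++ B)
  flush sorted B↑ B-pending =
    AllPairs.++⁺ increasing B↑ (All.tabulate λ a∈ → All.tabulate λ b∈ → below-pending a∈ (B-pending b∈))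
    where open SortedSoFar sorted

  stacked-sorted : ∀ {t r u v} → Consecutive (t ∷ r) → Consecutive (u ∷ v) → t < u →
                   (∀ {b} → b ∈ t ∷ r → b ∉ u ∷ v) → AllPairs _<_ ((t ∷ r) ++ (u ∷ v))
  stacked-sorted c₁ c₂ t<u disjoint = AllPairs.++⁺ (consecutive⇒sorted c₁) (consecutive⇒sorted c₂)
    (All.tabulate λ a∈ → All.tabulate λ b∈ →
      consecutive-below c₁ a∈ (λ b∈′ → disjoint b∈′ b∈) (<-≤-trans t<u (consecutive-head≤ c₂ b∈)))

  finish-sorted : ∀ {S₁ S₂ out} → StackInvariant π S₁ S₂ out → SortedSoFar S₁ S₂ out [] →
                  AllPairs _<_ (finish (st S₁ S₂ out)) × finish (st S₁ S₂ out) ↭ π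
  finish-sorted {[]}    {S₂}    inv sorted =
    flush sorted (consecutive⇒sorted consecutive₂) (inj₂ ∘ inj₁) , conserved
    where open StackInvariant inv
  finish-sorted {t ∷ r} {[]}    {out} inv sorted =
    flush sorted (consecutive⇒sorted consecutive₁) inj₁
    , subst (λ L → out ++ L ↭ π) (++-identityʳ (t ∷ r)) conserved
    where open StackInvariant inv
  finish-sorted {t ∷ r} {u ∷ v} {out} inv sorted with suc t ≤ᵇ u in t<?u
  ... | true  = flush sorted (stacked-sorted consecutive₁ consecutive₂ (<ᵇ-true t<?u) stacks-disjoint) pending
              , conserved
    where
    open StackInvariant inv
    open Stacks π-unique inv
    pending : ∀ {b} → b ∈ (t ∷ r) ++ (u ∷ v) → Pending (t ∷ r) (u ∷ v) [] b
    pending b∈ with ∈-++⁻ (t ∷ r) b∈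
    ... | inj₁ b∈₁ = inj₁ b∈₁
    ... | inj₂ b∈₂ = inj₂ (inj₁ b∈₂)
  ... | false = flush sorted (stacked-sorted consecutive₂ consecutive₁ u<t (flip stacks-disjoint)) pending
              , ↭-trans (++⁺ˡ out (++-comm (u ∷ v) (t ∷ r))) conserved
    where
    open StackInvariant inv
    open Stacks π-unique inv
    u<t : u < t
    u<t = ≤∧≢⇒< (≮⇒≥ (<ᵇ-false t<?u)) λ { refl → stacks-disjoint (here refl) (here refl) }
    pending : ∀ {b} → b ∈ (u ∷ v) ++ (t ∷ r) → Pending (t ∷ r) (u ∷ v) [] b
    pending b∈ with ∈-++⁻ (u ∷ v) b∈
    ... | inj₁ b∈₂ = inj₂ (inj₁ b∈₂)
    ... | inj₂ b∈₁ = inj₁ b∈₁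

  run-sorted : ∀ S P s → P ++ S ≡ π → Invariant P s → SortedSoFarₛ s S →
               (AllPairs _<_ (finish (run s S)) × finish (run s S) ↭ π) ⊎ Stuck
  run-sorted []      P s π≡ inv sorted =
    inj₁ (finish-sorted (subst (λ L → Invariant L s) (trans (sym (++-identityʳ P)) π≡) inv) sorted)
  run-sorted (x ∷ S) P s π≡ inv sorted with Step.sortedSoFar-step π≡ inv sorted
  ... | inj₂ stuck   = inj₂ stuck
  ... | inj₁ sorted′ = run-sorted S (P ++ [ x ]) (step s x) (trans (++-assoc P [ x ] S) π≡)
                         (Reading.invariant-step π≡ inv) sorted′

  psbp-sorted : (AllPairs _<_ (PSBP π) × PSBP π ↭ π) ⊎ Stuck
  psbp-sorted = run-sorted π [] initial refl invariant-initial (record { increasing = [] ; below-pending = λ () })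

module Obstruction {n : ℕ} {π : List ℕ} (perm : IsPerm n π) (av : Av basis π) where
  open Sortability perm

  forbid : ∀ {ρ} → Avoids π ρ → ∀ c {_ : True (all? (λ j → (1 ≤? j) ×-dec (j ≤? length c)) ρ)} →
           Linked _<_ c → let σ = map (λ j → nth c (j ∸ 1)) ρ in
           All (_∈ π) σ → Linked (Precedes π) σ → ⊥
  forbid avoids c {inRange} c↑ σ∈ σ≺ = avoids (sortedValues⇒contains c↑ (toWitness inRange) σ∈ σ≺)

  avoids2341 : Avoids π (2 ∷ 3 ∷ 4 ∷ 1 ∷ [])
  avoids2341 = All.lookup av (here refl)
  avoids25314 : Avoids π (2 ∷ 5 ∷ 3 ∷ 1 ∷ 4 ∷ [])
  avoids25314 = All.lookup av (there (here refl))
  avoids42513 : Avoids π (4 ∷ 2 ∷ 5 ∷ 1 ∷ 3 ∷ [])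
  avoids42513 = All.lookup av (there (there (here refl)))
  avoids42531 : Avoids π (4 ∷ 2 ∷ 5 ∷ 3 ∷ 1 ∷ [])
  avoids42531 = All.lookup av (there (there (there (here refl))))
  avoids45213 : Avoids π (4 ∷ 5 ∷ 2 ∷ 1 ∷ 3 ∷ [])
  avoids45213 = All.lookup av (there (there (there (there (here refl)))))
  avoids45231 : Avoids π (4 ∷ 5 ∷ 2 ∷ 3 ∷ 1 ∷ [])
  avoids45231 = All.lookup av (there (there (there (there (there (here refl))))))
  avoids52314 : Avoids π (5 ∷ 2 ∷ 3 ∷ 1 ∷ 4 ∷ [])
  avoids52314 = All.lookup av (there (there (there (there (there (there (here refl)))))))
  avoids642135 : Avoids π (6 ∷ 4 ∷ 2 ∷ 1 ∷ 3 ∷ 5 ∷ [])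
  avoids642135 = All.lookup av (there (there (there (there (there (there (there (here refl))))))))
  avoids642153 : Avoids π (6 ∷ 4 ∷ 2 ∷ 1 ∷ 5 ∷ 3 ∷ [])
  avoids642153 = All.lookup av (there (there (there (there (there (there (there (there (here refl)))))))))

  precedes-or-follows : ∀ {a b} → a ∈ π → b ∈ π → a ≢ b → pos a < pos b ⊎ pos b < pos a
  precedes-or-follows a∈ b∈ a≢b with <-cmp (pos _) (pos _)
  ... | tri< a≺b _ _ = inj₁ a≺b
  ... | tri≈ _ eq _  = ⊥-elim (a≢b (position-injective b∈ eq))
  ... | tri> _ _ b≺a = inj₂ b≺a

  pred∈π : ∀ {v y} → y ∈ π → y < v → v ∈ π → pred v ∈ π
  pred∈π {suc v} y∈ y<v v∈ =
    inRange⇒∈π (≤-trans (proj₁ (∈π⇒inRange y∈)) (≤-pred y<v) , ≤-trans (n≤1+n v) (proj₂ (∈π⇒inRange v∈)))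

  pred-placed : ∀ {v x y} → y ∈ π → y < v → v ∈ π → x ∈ π → suc x ≢ v → NoPredAfter (pos x) v →
                pos (pred v) < pos v ⊎ pos x < pos (pred v)
  pred-placed {suc v} {x} y∈ y<v v∈ x∈ x+1≢v waiting
    with precedes-or-follows (pred∈π y∈ y<v v∈) v∈ (<⇒≢ (n<1+n v))
  ... | inj₁ v⁻≺v = inj₁ v⁻≺v
  ... | inj₂ v≺v⁻ with precedes-or-follows (pred∈π y∈ y<v v∈) x∈ (λ { refl → x+1≢v refl })
  ...   | inj₁ v⁻≺x = ⊥-elim (waiting v≺v⁻ v⁻≺x)
  ...   | inj₂ x≺v⁻ = inj₂ x≺v⁻

  module Configuration {t u x y} (t<u : t < u) (t∈ : t ∈ π) (u∈ : u ∈ π) (x∈ : x ∈ π) (y∈ : y ∈ π)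
    (t≺x : pos t < pos x) (u≺x : pos u < pos x) (x≺y : pos x < pos y) (y<t : y < t) (y<x : y < x)
    (x+1≢t : suc x ≢ t) (x+1≢u : suc x ≢ u) (t-waiting : NoPredAfter (pos x) t) (u-waiting : NoPredAfter (pos x) u)
    where

    order : ∀ {a b} → a ∈ π → b ∈ π → a < b → pos a < pos b ⊎ pos b < pos a
    order a∈ b∈ a<b = precedes-or-follows a∈ b∈ (<⇒≢ a<b)

    t⁻ u⁻ : ℕ
    t⁻ = pred t
    u⁻ = pred u

    y<u : y < u
    y<u = <-trans y<t t<u

    u≺y : pos u < pos y
    u≺y = <-trans u≺x x≺y

    t⁻∈ : t⁻ ∈ π
    t⁻∈ = pred∈π y∈ y<t t∈

    u⁻∈ : u⁻ ∈ π
    u⁻∈ = pred∈π y∈ y<u u∈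

    t⁻<t : t⁻ < t
    t⁻<t = pred< y<t

    u⁻<u : u⁻ < u
    u⁻<u = pred< y<u

    t≤u⁻ : t ≤ u⁻
    t≤u⁻ = <⇒≤pred t<u

    y<u⁻ : y < u⁻
    y<u⁻ = <-≤-trans y<t t≤u⁻

    t⁻-placed : pos t⁻ < pos t ⊎ pos x < pos t⁻
    t⁻-placed = pred-placed y∈ y<t t∈ x∈ x+1≢t t-waiting

    u⁻-placed : pos u⁻ < pos u ⊎ pos x < pos u⁻
    u⁻-placed = pred-placed y∈ y<u u∈ x∈ x+1≢u u-waiting

    module XAboveTops (u<x : u < x) (u≺t : pos u < pos t) (x≺u⁻ : pos x < pos u⁻) where
      t<u⁻ : t < u⁻
      t<u⁻ = ≤∧≢⇒< t≤u⁻ λ { refl → <-asym t≺x x≺u⁻ }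

      contradiction : ⊥
      contradiction with order y∈ u⁻∈ y<u⁻
      ... | inj₁ y≺u⁻ = forbid avoids42513 (y ∷ t ∷ u⁻ ∷ u ∷ x ∷ []) (y<t ∷ t<u⁻ ∷ u⁻<u ∷ u<x ∷ [-])
                          (u∈ ∷ t∈ ∷ x∈ ∷ y∈ ∷ u⁻∈ ∷ []) (u≺t ∷ t≺x ∷ x≺y ∷ y≺u⁻ ∷ [-])
      ... | inj₂ u⁻≺y = forbid avoids42531 (y ∷ t ∷ u⁻ ∷ u ∷ x ∷ []) (y<t ∷ t<u⁻ ∷ u⁻<u ∷ u<x ∷ [-])
                          (u∈ ∷ t∈ ∷ x∈ ∷ u⁻∈ ∷ y∈ ∷ []) (u≺t ∷ t≺x ∷ x≺u⁻ ∷ u⁻≺y ∷ [-])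

    x-above-tops : u < x → ⊥
    x-above-tops u<x with order t∈ u∈ t<u | u⁻-placed
    ... | inj₁ t≺u | _ = forbid avoids2341 (y ∷ t ∷ u ∷ x ∷ []) (y<t ∷ t<u ∷ u<x ∷ [-])
                           (t∈ ∷ u∈ ∷ x∈ ∷ y∈ ∷ []) (t≺u ∷ u≺x ∷ x≺y ∷ [-])
    ... | inj₂ u≺t | inj₁ u⁻≺u = forbid avoids2341 (y ∷ u⁻ ∷ u ∷ x ∷ []) (y<u⁻ ∷ u⁻<u ∷ u<x ∷ [-])
                                   (u⁻∈ ∷ u∈ ∷ x∈ ∷ y∈ ∷ []) (u⁻≺u ∷ u≺x ∷ x≺y ∷ [-])
    ... | inj₂ u≺t | inj₂ x≺u⁻ = XAboveTops.contradiction u<x u≺t x≺u⁻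

    module XBetweenTops (t<x : t < x) (x<u : x < u) where
      x<u⁻ : x < u⁻
      x<u⁻ = below-pred x<u x+1≢u

      t<u⁻ : t < u⁻
      t<u⁻ = <-trans t<x x<u⁻

      u⁻-late : pos x < pos u⁻ → ⊥
      u⁻-late x≺u⁻ with order y∈ u⁻∈ (<-trans y<x x<u⁻) | order t∈ u∈ t<u
      ... | inj₂ u⁻≺y | _ = forbid avoids2341 (y ∷ t ∷ x ∷ u⁻ ∷ []) (y<t ∷ t<x ∷ x<u⁻ ∷ [-])
                              (t∈ ∷ x∈ ∷ u⁻∈ ∷ y∈ ∷ []) (t≺x ∷ x≺u⁻ ∷ u⁻≺y ∷ [-])
      ... | inj₁ y≺u⁻ | inj₁ t≺u = forbid avoids25314 (y ∷ t ∷ x ∷ u⁻ ∷ u ∷ []) (y<t ∷ t<x ∷ x<u⁻ ∷ u⁻<u ∷ [-])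
                                     (t∈ ∷ u∈ ∷ x∈ ∷ y∈ ∷ u⁻∈ ∷ []) (t≺u ∷ u≺x ∷ x≺y ∷ y≺u⁻ ∷ [-])
      ... | inj₁ y≺u⁻ | inj₂ u≺t = forbid avoids52314 (y ∷ t ∷ x ∷ u⁻ ∷ u ∷ []) (y<t ∷ t<x ∷ x<u⁻ ∷ u⁻<u ∷ [-])
                                     (u∈ ∷ t∈ ∷ x∈ ∷ y∈ ∷ u⁻∈ ∷ []) (u≺t ∷ t≺x ∷ x≺y ∷ y≺u⁻ ∷ [-])

      u⁻-early : pos u⁻ < pos u → ⊥
      u⁻-early u⁻≺u with order t∈ u⁻∈ t<u⁻ | order t∈ u∈ t<u
      ... | inj₁ t≺u⁻ | _ = forbid avoids2341 (y ∷ t ∷ u⁻ ∷ u ∷ []) (y<t ∷ t<u⁻ ∷ u⁻<u ∷ [-])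
                              (t∈ ∷ u⁻∈ ∷ u∈ ∷ y∈ ∷ []) (t≺u⁻ ∷ u⁻≺u ∷ u≺y ∷ [-])
      ... | inj₂ u⁻≺t | inj₁ t≺u = forbid avoids42531 (y ∷ t ∷ x ∷ u⁻ ∷ u ∷ []) (y<t ∷ t<x ∷ x<u⁻ ∷ u⁻<u ∷ [-])
                                     (u⁻∈ ∷ t∈ ∷ u∈ ∷ x∈ ∷ y∈ ∷ []) (u⁻≺t ∷ t≺u ∷ u≺x ∷ x≺y ∷ [-])
      ... | inj₂ u⁻≺t | inj₂ u≺t = forbid avoids45231 (y ∷ t ∷ x ∷ u⁻ ∷ u ∷ []) (y<t ∷ t<x ∷ x<u⁻ ∷ u⁻<u ∷ [-])
                                     (u⁻∈ ∷ u∈ ∷ t∈ ∷ x∈ ∷ y∈ ∷ []) (u⁻≺u ∷ u≺t ∷ t≺x ∷ x≺y ∷ [-])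

    x-between-tops : t < x → x < u → ⊥
    x-between-tops t<x x<u = Sum.[ u⁻-early , u⁻-late ] u⁻-placed
      where open XBetweenTops t<x x<u

    module XBelowTops (x<t : x < t) where
      x<t⁻ : x < t⁻
      x<t⁻ = below-pred x<t x+1≢t

      y<t⁻ : y < t⁻
      y<t⁻ = <-trans y<x x<t⁻

      t-first : pos t < pos u → ⊥
      t-first t≺u with t⁻-placed
      ... | inj₁ t⁻≺t = forbid avoids2341 (x ∷ t⁻ ∷ t ∷ u ∷ []) (x<t⁻ ∷ t⁻<t ∷ t<u ∷ [-])
                          (t⁻∈ ∷ t∈ ∷ u∈ ∷ x∈ ∷ []) (t⁻≺t ∷ t≺u ∷ u≺x ∷ [-])
      ... | inj₂ x≺t⁻ with order y∈ t⁻∈ y<t⁻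
      ...   | inj₁ y≺t⁻ = forbid avoids45213 (y ∷ x ∷ t⁻ ∷ t ∷ u ∷ []) (y<x ∷ x<t⁻ ∷ t⁻<t ∷ t<u ∷ [-])
                            (t∈ ∷ u∈ ∷ x∈ ∷ y∈ ∷ t⁻∈ ∷ []) (t≺u ∷ u≺x ∷ x≺y ∷ y≺t⁻ ∷ [-])
      ...   | inj₂ t⁻≺y = forbid avoids45231 (y ∷ x ∷ t⁻ ∷ t ∷ u ∷ []) (y<x ∷ x<t⁻ ∷ t⁻<t ∷ t<u ∷ [-])
                            (t∈ ∷ u∈ ∷ x∈ ∷ t⁻∈ ∷ y∈ ∷ []) (t≺u ∷ u≺x ∷ x≺t⁻ ∷ t⁻≺y ∷ [-])

      module UFirst (u≺t : pos u < pos t) where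
        t<u⁻ : t < u⁻
        t<u⁻ = ≤∧≢⇒< t≤u⁻ λ { refl → Sum.[ <-asym u≺t , <-asym t≺x ] u⁻-placed }

        t⁻<u⁻ : t⁻ < u⁻
        t⁻<u⁻ = <-trans t⁻<t t<u⁻

        t⁻<u : t⁻ < u
        t⁻<u = <-trans t⁻<t t<u

        both-late : pos x < pos t⁻ → pos x < pos u⁻ → ⊥
        both-late x≺t⁻ x≺u⁻ with order y∈ t⁻∈ y<t⁻ | order y∈ u⁻∈ y<u⁻ | order t⁻∈ u⁻∈ t⁻<u⁻
        ... | inj₁ y≺t⁻ | inj₁ y≺u⁻ | inj₁ t⁻≺u⁻ =
          forbid avoids642135 (y ∷ x ∷ t⁻ ∷ t ∷ u⁻ ∷ u ∷ []) (y<x ∷ x<t⁻ ∷ t⁻<t ∷ t<u⁻ ∷ u⁻<u ∷ [-])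
            (u∈ ∷ t∈ ∷ x∈ ∷ y∈ ∷ t⁻∈ ∷ u⁻∈ ∷ []) (u≺t ∷ t≺x ∷ x≺y ∷ y≺t⁻ ∷ t⁻≺u⁻ ∷ [-])
        ... | inj₁ y≺t⁻ | inj₁ y≺u⁻ | inj₂ u⁻≺t⁻ =
          forbid avoids642153 (y ∷ x ∷ t⁻ ∷ t ∷ u⁻ ∷ u ∷ []) (y<x ∷ x<t⁻ ∷ t⁻<t ∷ t<u⁻ ∷ u⁻<u ∷ [-])
            (u∈ ∷ t∈ ∷ x∈ ∷ y∈ ∷ u⁻∈ ∷ t⁻∈ ∷ []) (u≺t ∷ t≺x ∷ x≺y ∷ y≺u⁻ ∷ u⁻≺t⁻ ∷ [-])
        ... | inj₁ y≺t⁻ | inj₂ u⁻≺y | _ =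
          forbid avoids42513 (y ∷ x ∷ t⁻ ∷ t ∷ u⁻ ∷ []) (y<x ∷ x<t⁻ ∷ t⁻<t ∷ t<u⁻ ∷ [-])
            (t∈ ∷ x∈ ∷ u⁻∈ ∷ y∈ ∷ t⁻∈ ∷ []) (t≺x ∷ x≺u⁻ ∷ u⁻≺y ∷ y≺t⁻ ∷ [-])
        ... | inj₂ t⁻≺y | inj₁ y≺u⁻ | _ =
          forbid avoids52314 (y ∷ x ∷ t⁻ ∷ u⁻ ∷ u ∷ []) (y<x ∷ x<t⁻ ∷ t⁻<u⁻ ∷ u⁻<u ∷ [-])
            (u∈ ∷ x∈ ∷ t⁻∈ ∷ y∈ ∷ u⁻∈ ∷ []) (u≺x ∷ x≺t⁻ ∷ t⁻≺y ∷ y≺u⁻ ∷ [-])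
        ... | inj₂ t⁻≺y | inj₂ u⁻≺y | inj₁ t⁻≺u⁻ =
          forbid avoids2341 (y ∷ x ∷ t⁻ ∷ u⁻ ∷ []) (y<x ∷ x<t⁻ ∷ t⁻<u⁻ ∷ [-])
            (x∈ ∷ t⁻∈ ∷ u⁻∈ ∷ y∈ ∷ []) (x≺t⁻ ∷ t⁻≺u⁻ ∷ u⁻≺y ∷ [-])
        ... | inj₂ t⁻≺y | inj₂ u⁻≺y | inj₂ u⁻≺t⁻ =
          forbid avoids42531 (y ∷ x ∷ t⁻ ∷ t ∷ u⁻ ∷ []) (y<x ∷ x<t⁻ ∷ t⁻<t ∷ t<u⁻ ∷ [-])
            (t∈ ∷ x∈ ∷ u⁻∈ ∷ t⁻∈ ∷ y∈ ∷ []) (t≺x ∷ x≺u⁻ ∷ u⁻≺t⁻ ∷ t⁻≺y ∷ [-])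

        t⁻-late : pos x < pos t⁻ → pos u⁻ < pos u → ⊥
        t⁻-late x≺t⁻ u⁻≺u with order y∈ t⁻∈ y<t⁻
        ... | inj₁ y≺t⁻ = forbid avoids45213 (y ∷ x ∷ t⁻ ∷ u⁻ ∷ u ∷ []) (y<x ∷ x<t⁻ ∷ t⁻<u⁻ ∷ u⁻<u ∷ [-])
                            (u⁻∈ ∷ u∈ ∷ x∈ ∷ y∈ ∷ t⁻∈ ∷ []) (u⁻≺u ∷ u≺x ∷ x≺y ∷ y≺t⁻ ∷ [-])
        ... | inj₂ t⁻≺y = forbid avoids45231 (y ∷ x ∷ t⁻ ∷ u⁻ ∷ u ∷ []) (y<x ∷ x<t⁻ ∷ t⁻<u⁻ ∷ u⁻<u ∷ [-])
                            (u⁻∈ ∷ u∈ ∷ x∈ ∷ t⁻∈ ∷ y∈ ∷ []) (u⁻≺u ∷ u≺x ∷ x≺t⁻ ∷ t⁻≺y ∷ [-])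

        u⁻-late : pos t⁻ < pos t → pos x < pos u⁻ → ⊥
        u⁻-late t⁻≺t x≺u⁻ with order t⁻∈ u∈ t⁻<u
        ... | inj₁ t⁻≺u = forbid avoids25314 (x ∷ t⁻ ∷ t ∷ u⁻ ∷ u ∷ []) (x<t⁻ ∷ t⁻<t ∷ t<u⁻ ∷ u⁻<u ∷ [-])
                            (t⁻∈ ∷ u∈ ∷ t∈ ∷ x∈ ∷ u⁻∈ ∷ []) (t⁻≺u ∷ u≺t ∷ t≺x ∷ x≺u⁻ ∷ [-])
        ... | inj₂ u≺t⁻ = forbid avoids52314 (x ∷ t⁻ ∷ t ∷ u⁻ ∷ u ∷ []) (x<t⁻ ∷ t⁻<t ∷ t<u⁻ ∷ u⁻<u ∷ [-])
                            (u∈ ∷ t⁻∈ ∷ t∈ ∷ x∈ ∷ u⁻∈ ∷ []) (u≺t⁻ ∷ t⁻≺t ∷ t≺x ∷ x≺u⁻ ∷ [-])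

        both-early : pos t⁻ < pos t → pos u⁻ < pos u → ⊥
        both-early t⁻≺t u⁻≺u with order t⁻∈ u⁻∈ t⁻<u⁻ | order t⁻∈ u∈ t⁻<u
        ... | inj₁ t⁻≺u⁻ | _ = forbid avoids2341 (x ∷ t⁻ ∷ u⁻ ∷ u ∷ []) (x<t⁻ ∷ t⁻<u⁻ ∷ u⁻<u ∷ [-])
                                 (t⁻∈ ∷ u⁻∈ ∷ u∈ ∷ x∈ ∷ []) (t⁻≺u⁻ ∷ u⁻≺u ∷ u≺x ∷ [-])
        ... | inj₂ u⁻≺t⁻ | inj₁ t⁻≺u =
          forbid avoids42531 (x ∷ t⁻ ∷ t ∷ u⁻ ∷ u ∷ []) (x<t⁻ ∷ t⁻<t ∷ t<u⁻ ∷ u⁻<u ∷ [-])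
            (u⁻∈ ∷ t⁻∈ ∷ u∈ ∷ t∈ ∷ x∈ ∷ []) (u⁻≺t⁻ ∷ t⁻≺u ∷ u≺t ∷ t≺x ∷ [-])
        ... | inj₂ u⁻≺t⁻ | inj₂ u≺t⁻ =
          forbid avoids45231 (x ∷ t⁻ ∷ t ∷ u⁻ ∷ u ∷ []) (x<t⁻ ∷ t⁻<t ∷ t<u⁻ ∷ u⁻<u ∷ [-])
            (u⁻∈ ∷ u∈ ∷ t⁻∈ ∷ t∈ ∷ x∈ ∷ []) (u⁻≺u ∷ u≺t⁻ ∷ t⁻≺t ∷ t≺x ∷ [-])

        contradiction : ⊥
        contradiction with t⁻-placed | u⁻-placed
        ... | inj₁ t⁻≺t | inj₁ u⁻≺u = both-early t⁻≺t u⁻≺u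
        ... | inj₁ t⁻≺t | inj₂ x≺u⁻ = u⁻-late t⁻≺t x≺u⁻
        ... | inj₂ x≺t⁻ | inj₁ u⁻≺u = t⁻-late x≺t⁻ u⁻≺u
        ... | inj₂ x≺t⁻ | inj₂ x≺u⁻ = both-late x≺t⁻ x≺u⁻

    x-below-tops : x < t → ⊥
    x-below-tops x<t = Sum.[ t-first , UFirst.contradiction ] (order t∈ u∈ t<u)
      where open XBelowTops x<t

    impossible : ⊥
    impossible with <-cmp x t | <-cmp x u
    ... | tri< x<t _ _ | _            = x-below-tops x<t
    ... | tri≈ _ refl _ | _           = <-irrefl refl t≺x
    ... | tri> _ _ t<x | tri< x<u _ _ = x-between-tops t<x x<u
    ... | tri> _ _ _   | tri≈ _ refl _ = <-irrefl refl u≺x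
    ... | tri> _ _ _   | tri> _ _ u<x = x-above-tops u<x

  open AvoidsSorted perm using (Stuck)

  stuck-impossible : Stuck → ⊥
  stuck-impossible stuck = by-order (<-cmp t u)
    where
    open Stuck stuck
    open Reading π≡
    t∈ : t ∈ π
    t∈ = ∈P⇒∈π t∈P
    u∈ : u ∈ π
    u∈ = ∈P⇒∈π u∈P
    y∈ : y ∈ π
    y∈ = ∈S⇒∈π y∈S
    t≺x : pos t < pos x
    t≺x = subst (pos t <_) (sym pos-x) (pos-P t∈P)
    u≺x : pos u < pos x
    u≺x = subst (pos u <_) (sym pos-x) (pos-P u∈P)
    x≺y : pos x < pos y
    x≺y = subst (_< pos y) (sym pos-x) (pos-S y∈S)
    at-x : ∀ {v} → NoPredAfter (length P) v → NoPredAfter (pos x) v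
    at-x {v} = subst (λ k → NoPredAfter k v) (sym pos-x)
    by-order : Tri (t < u) (t ≡ u) (u < t) → ⊥
    by-order (tri< t<u _ _) = Configuration.impossible t<u t∈ u∈ x∈π y∈ t≺x u≺x x≺y y<t y<x x+1≢t x+1≢u
                         (at-x waiting-t) (at-x waiting-u)
    by-order (tri≈ _ t≡u _) = t≢u t≡u
    by-order (tri> _ _ u<t) = Configuration.impossible u<t u∈ t∈ x∈π y∈ u≺x t≺x x≺y y<u y<x x+1≢u x+1≢t
                         (at-x waiting-u) (at-x waiting-t)

mainTheorem13 : (n : ℕ) (π : List ℕ) → IsPerm n π →
    SortedByPSBP π n ⇔ Av basis π
mainTheorem13 n π perm = mk⇔ (SortedAvoids.sorted⇒avoids perm) avoids⇒sorted
  where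
  avoids⇒sorted : Av basis π → SortedByPSBP π n
  avoids⇒sorted av with AvoidsSorted.psbp-sorted perm
  ... | inj₁ (increasing , PSBP↭π) = strictlySorted-↭⇒≡ increasing (oneTo-sorted n) (↭-trans PSBP↭π perm)
  ... | inj₂ stuck                  = ⊥-elim (Obstruction.stuck-impossible perm av stuck)
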